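{- Let $\mathcal{P}$ be a fence poset with chronological ordering $\mathcal{P}(1),\dots,\mathcal{P}(h)$, with labels and with weights in a commutative ring, having a reverse, kissing self-overlap $\mathcal{P}[r,s]\cong\overline{\mathcal{P}[s+1,t]}$. Put $Z_R=\prod_{i=s+1}^{t}\mathrm{wt}(\mathcal{P}(i))$, and $Z_t=\prod_{i=t+1}^{v-1}\mathrm{wt}(\mathcal{P}(i))$ if $r=1$ and $Z_t=1$ if $r>1$. Then $$\mathcal{W}(\mathcal{P})=\mathcal{W}(\mathcal{P}_{34})+Z_RZ_t\,\mathcal{W}(\mathcal{P}_{56}).$$
   Context: A fence poset with chronological ordering is a finite poset with an enumeration $\mathcal{P}(1),\dots,\mathcal{P}(h)$ such that for each $i<h$ exactly one of $\mathcal{P}(i)<\mathcal{P}(i+1)$, $\mathcal{P}(i)>\mathcal{P}(i+1)$ holds, the partial order being the transitive closure of these relations. $\mathcal{P}[i,j]$ is the subposet on $\mathcal{P}(i),\dots,\mathcal{P}(j)$ (empty if $j<i$); $\overline{\mathcal{Q}}$ denotes $\mathcal{Q}$ with reversed enumeration. For $\mathcal{Q},\mathcal{Q}'$, $\mathcal{Q}\searrow\mathcal{Q}'$ is the fence poset on the disjoint union with concatenated enumeration and the extra relation (last element of $\mathcal{Q}$) $>$ (first element of $\mathcal{Q}'$). Each element $x$ has a label and a weight $\mathrm{wt}(x)$; for a poset $\mathcal{Q}$, $\mathcal{W}(\mathcal{Q})=\sum_I\prod_{x\in I}\mathrm{wt}(x)$ over all order ideals (down-closed subsets, including $\emptyset$)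 $I$ of $\mathcal{Q}$; $\mathcal{W}(\emptyset)=1$. A subset $S$ is on top of $\mathcal{P}$ if there are no $x\in S$, $y\notin S$ with $x<y$, and on bottom if there are no $x\in S$, $y\notin S$ with $y<x$. A reverse, kissing self-overlap $\mathcal{P}[r,s]\cong\overline{\mathcal{P}[s+1,t]}$ consists of integers $1\le r\le s<t\le h$ with $s-r=t-s-1$ such that: (1) $\mathcal{P}[r,s]$ is on top of $\mathcal{P}$ and $\mathcal{P}[s+1,t]$ is on bottom of $\mathcal{P}$; (2) not both $r=1$ and $t=h$; (3) the bijection $\mathcal{P}(r+i)\mapsto\mathcal{P}(t-i)$, $0\le i\le s-r$, preserves labels and is an isomorphism of posets $\mathcal{P}[r,s]\to\mathcal{P}[s+1,t]$; (4) $\mathrm{wt}(\mathcal{P}(r+i))=\mathrm{wt}(\mathcal{P}(t-i))$ for $0\le i\le s-r-1$. Resolution: $\mathcal{P}_{34}$ is the fence poset on the elements of $\mathcal{P}$ with enumeration $\mathcal{P}(1),\dots,\mathcal{P}(r-1),\mathcal{P}(t),\mathcal{P}(t-1),\dots,\mathcal{P}(r),\mathcal{P}(t+1),\dots,\mathcal{P}(h)$, whose relations between consecutive elements are those of $\mathcal{P}$ inside $\mathcal{P}[1,r-1]$, inside $\mathcal{P}[r,t]$ and inside $\mathcal{P}[t+1,h]$, together with $\mathcal{P}(r-1)<\mathcal{P}(t)$ (if $r>1$) and $\mathcal{P}(r)<\mathcal{P}(t+1)$ (if $t<h$). $\mathcal{P}_{56}$ is: if $r>1$ and $t<h$, $\mathcal{P}[1,r-1]\searrow\mathcal{P}[t+1,h]$;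 if $r=1$, then $\mathcal{P}[v,h]$ where $v>t+1$ is the smallest integer $\le h$ with $\mathcal{P}(v)\not<\mathcal{P}(t+1)$ if it exists and $v=h+1$ otherwise; if $t=h$, then $\mathcal{P}[1,u]$ where $u<r-1$ is the largest integer $\ge1$ with $\mathcal{P}(u)\not>\mathcal{P}(r-1)$ if it exists and $u=0$ otherwise. -}

module Defs where

open import Level using (Level; _⊔_)
open import Data.Bool using (Bool; true; false; if_then_else_; not; _∨_)
open import Data.Nat using (ℕ; zero; suc; _+_; _∸_; _≤_; _<_; z≤n; s≤s; _<ᵇ_; _≡ᵇ_; _≤ᵇ_)
open import Data.Nat.Properties using (≤-refl; m≤n⇒m≤1+n; ≤-pred)
open import Data.Product using (_×_; _,_; proj₁; proj₂)
open import Data.List using (List; []; _∷_; concatMap; foldr)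
open import Data.Empty using (⊥; ⊥-elim)
open import Relation.Nullary using (¬_; Dec; yes; no; does)
open import Relation.Nullary.Decidable using (_→-dec_)
open import Relation.Binary.PropositionalEquality using (_≡_; refl)
import Data.Nat
import Data.Nat.Properties
open import Relation.Binary.Construct.Closure.Transitive using (TransClosure; [_]; _∷_)
open import Algebra.Bundles using (CommutativeRing)
open import Function using (_∘_)

-- A fence with elements carrying data in X is given by its length h,
-- the data `el i` of the element P(i) (1 ≤ i ≤ h), and for 1 ≤ i < h
-- the direction `up i` : `true` iff P(i) < P(i+1), `false` iff
-- P(i) > P(i+1).  Values of `up`, `el` outside these ranges are junk and
-- never used.  Elements are identified with their positions 1..h.

record Fence {x} (X : Set x) : Set x where
  constructor mkFence
  field
    len : ℕ
    up  : ℕ → Bool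
    el  : ℕ → X
open Fence public

module _ {x} {X : Set x} (F : Fence X) where

  data Cover : ℕ → ℕ → Set where
    up-step   : ∀ {i} → 1 ≤ i → suc i ≤ len F → up F i ≡ true  → Cover i (suc i)
    down-step : ∀ {i} → 1 ≤ i → suc i ≤ len F → up F i ≡ false → Cover (suc i) i

  Lt : ℕ → ℕ → Set
  Lt = TransClosure Cover

  IsOrderIdeal : (ℕ → Bool) → Set
  IsOrderIdeal S = ∀ {a b} → Lt a b → S b ≡ true → S a ≡ true

  OnTop : (ℕ → Set) → Set
  OnTop S = ∀ a b → S a → ¬ S b → ¬ Lt a b

  OnBottom : (ℕ → Set) → Set
  OnBottom S = ∀ a b → S a → ¬ S b → ¬ Lt b a

infix 4 _<[_]_
_<[_]_ : ∀ {x} {X : Set x} → ℕ → Fence X → ℕ → Set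
a <[ F ] b = Lt F a b

Interval : ℕ → ℕ → ℕ → Set
Interval i j a = i ≤ a × a ≤ j

private
  all<? : (P : ℕ → Set) → (∀ i → Dec (P i)) → ∀ n → Dec (∀ i → i < n → P i)
  all<? P P? zero = yes λ i ()
  all<? P P? (suc n) with all<? P P? n | P? n
  ... | no ¬h | _ = no λ h → ¬h (λ i i<n → h i (m≤n⇒m≤1+n i<n))
  ... | yes h | no ¬p = no λ h′ → ¬p (h′ n ≤-refl)
  ... | yes h | yes p = yes λ i i<1+n → go i (≤-pred i<1+n)
    where
    go : ∀ i → i ≤ n → P i
    go i i≤n with i Data.Nat.≟ n
    ... | yes refl = p
    ... | no i≢n = h i (Data.Nat.Properties.≤∧≢⇒< i≤n i≢n)

  1≤? : ∀ i → Dec (1 ≤ i)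
  1≤? zero = no λ ()
  1≤? (suc i) = yes (s≤s z≤n)

  ≡true? : ∀ b → Dec (b ≡ true)
  ≡true? true = yes refl
  ≡true? false = no λ ()

module _ {x} {X : Set x} (F : Fence X) (S : ℕ → Bool) where

  coverOK : ℕ → Bool
  coverOK i = if up F i then not (S (suc i)) ∨ S i else not (S i) ∨ S (suc i)

  private
    AllOK : Set
    AllOK = ∀ i → i < len F → 1 ≤ i → coverOK i ≡ true

    allOK? : Dec AllOK
    allOK? = all<? _ (λ i → 1≤? i →-dec ≡true? (coverOK i)) (len F)

    ok⇒cover : AllOK → ∀ {a b} → Cover F a b → S b ≡ true → S a ≡ true
    ok⇒cover ok (up-step {i} 1≤i i<h u) Sb with ok i i<h 1≤i
    ... | c rewrite u | Sb with S i
    ... | true = refl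
    ok⇒cover ok (down-step {i} 1≤i i<h u) Sb with ok i i<h 1≤i
    ... | c rewrite u | Sb with S (suc i)
    ... | true = refl

    cover⇒lt : (∀ {a b} → Cover F a b → S b ≡ true → S a ≡ true) → IsOrderIdeal F S
    cover⇒lt c [ ab ] Sb = c ab Sb
    cover⇒lt c (ab ∷ bz) Sz = c ab (cover⇒lt c bz Sz)

    lt⇒ok : IsOrderIdeal F S → AllOK
    lt⇒ok I i i<h 1≤i with up F i in u
    ... | true with S (suc i) in e
    ...   | false = refl
    ...   | true rewrite I [ up-step 1≤i i<h u ] e = refl
    lt⇒ok I i i<h 1≤i | false with S i in e
    ...   | false = refl
    ...   | true rewrite I [ down-step 1≤i i<h u ] e = refl

  isOrderIdeal? : Dec (IsOrderIdeal F S)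
  isOrderIdeal? with allOK?
  ... | yes ok = yes (cover⇒lt (ok⇒cover ok))
  ... | no ¬ok = no λ I → ¬ok (lt⇒ok I)

-- P[i,j] (for i ≥ 1): positions 1..(j+1-i) correspond to P(i),…,P(j); empty if j < i
sub : ∀ {x} {X : Set x} → Fence X → ℕ → ℕ → Fence X
sub F i j = mkFence (suc j ∸ i) (λ k → up F (k + i ∸ 1)) (λ k → el F (k + i ∸ 1))

-- Q ↘ Q' : concatenated enumeration, extra relation (last of Q) > (first of Q')
_↘_ : ∀ {x} {X : Set x} → Fence X → Fence X → Fence X
Q ↘ Q' = mkFence (len Q + len Q')
  (λ k → if k <ᵇ len Q then up Q k else if k ≡ᵇ len Q then false else up Q' (k ∸ len Q))
  (λ k → if k ≤ᵇ len Q then el Q k else el Q' (k ∸ len Q))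

mapFence : ∀ {x y} {X : Set x} {Y : Set y} → (X → Y) → Fence X → Fence Y
mapFence f F = mkFence (len F) (up F) (f ∘ el F)

-- P₃₄ : enumeration P(1),…,P(r-1),P(t),P(t-1),…,P(r),P(t+1),…,P(h)
P34 : ∀ {x} {X : Set x} → Fence X → ℕ → ℕ → Fence X
P34 F r t = mkFence (len F) up34 (λ k → el F (π k))
  where
  π : ℕ → ℕ
  π k = if k <ᵇ r then k else if t <ᵇ k then k else t + r ∸ k
  up34 : ℕ → Bool
  up34 k =
    if suc k <ᵇ r then up F k                      -- inside P[1,r-1]
    else if suc k ≡ᵇ r then true                   -- P(r-1) < P(t)
    else if k <ᵇ t then not (up F (t + r ∸ suc k)) -- inside P[r,t], reversed
    else if k ≡ᵇ t then true                       -- P(r) < P(t+1)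
    else up F k                                    -- inside P[t+1,h]

P56 : ∀ {x} {X : Set x} → Fence X → (r t v u : ℕ) → Fence X
P56 F r t v u =
  if r ≡ᵇ 1 then sub F v (len F)
  else if t ≡ᵇ len F then sub F 1 u
  else (sub F 1 (r ∸ 1) ↘ sub F (suc t) (len F))

IsV : ∀ {x} {X : Set x} → Fence X → (t v : ℕ) → Set
IsV F t v = suc t < v × v ≤ suc (len F)
  × (∀ w → suc t < w → w < v → w <[ F ] suc t)
  × (v ≤ len F → ¬ (v <[ F ] suc t))

IsU : ∀ {x} {X : Set x} → Fence X → (r u : ℕ) → Set
IsU F r u = u < r ∸ 1
  × (∀ w → u < w → w < r ∸ 1 → (r ∸ 1) <[ F ] w)
  × (1 ≤ u → ¬ ((r ∸ 1) <[ F ] u))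

module WithRing {c ℓ} (R : CommutativeRing c ℓ) where
  open CommutativeRing R renaming (_+_ to _+R_; _*_ to _*R_)

  prodRange : (ℕ → Carrier) → ℕ → ℕ → Carrier
  prodRange f a b = go (suc b ∸ a) a
    where
    go : ℕ → ℕ → Carrier
    go zero    i = 1#
    go (suc n) i = f i *R go n (suc i)

  subsets : ℕ → List (ℕ → Bool)
  subsets zero = (λ _ → false) ∷ []
  subsets (suc n) = concatMap (λ S → S ∷ (λ k → if k ≡ᵇ suc n then true else S k) ∷ []) (subsets n)

  W : Fence Carrier → Carrier
  W F = foldr (λ S acc → term S +R acc) 0# (subsets (len F))
    where
    term : (ℕ → Bool) → Carrier
    term S = if does (isOrderIdeal? F S)
             then prodRange (λ i → if S i then el F i else 1#) 1 (len F)
             else 0#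

  record ReverseKissing {a} {L : Set a} (P : Fence L) (wt : ℕ → Carrier) (r s t : ℕ) : Set (a ⊔ ℓ) where
    field
      1≤r : 1 ≤ r
      r≤s : r ≤ s
      s<t : s < t
      t≤h : t ≤ len P
      lengths : s ∸ r ≡ t ∸ suc s
      top    : OnTop P (Interval r s)
      bottom : OnBottom P (Interval (suc s) t)
      notBoth : ¬ (r ≡ 1 × t ≡ len P)
      labels : ∀ i → i ≤ s ∸ r → el P (r + i) ≡ el P (t ∸ i)
      iso    : ∀ i j → i ≤ s ∸ r → j ≤ s ∸ r →
               ((r + i) <[ P ] (r + j) → (t ∸ i) <[ P ] (t ∸ j))
               × ((t ∸ i) <[ P ] (t ∸ j) → (r + i) <[ P ] (r + j))
      weights : ∀ i → i < s ∸ r → wt (r + i) ≈ wt (t ∸ i)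

  Identity : ∀ {a} {L : Set a} (P : Fence L) (wt : ℕ → Carrier) (r s t v u : ℕ) → Set ℓ
  Identity P wt r s t v u = W Pw ≈ W (P34 Pw r t) +R (ZR *R Zt) *R W (P56 Pw r t v u)
    where
    Pw : Fence Carrier
    Pw = mkFence (len P) (up P) wt
    ZR : Carrier
    ZR = prodRange wt (suc s) t
    Zt : Carrier
    Zt = if r ≡ᵇ 1 then prodRange wt (suc t) (v ∸ 1) else 1#

-- 𝒲 of a fence is a transfer-matrix product: with a 2 × 2 matrix D(w) for an element
-- of weight w and C(up), C(down) for the steps, 𝒲(P) is the sum of the entries of
-- D(w₁) C₁ D(w₂) ⋯ C_{h-1} D(w_h).  Cutting P at its up-steps P(r-1) < P(r) and
-- P(t) < P(t+1) gives 𝒲(P) = Σ L C(up) K C(up) R, and as reading a block backwards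
-- transposes its matrix, 𝒲(P₃₄) = Σ L C(up) Kᵀ C(up) R.  The kissing self-overlap
-- writes K as a congruence Yᵀ Z Y with Z₂₁ - Z₁₂ = wt(P(s+1)); congruence multiplies
-- this skew part by det Y, a product of weights, so K₂₁ - K₁₂ = Z_R and
-- 𝒲(P) - 𝒲(P₃₄) = Z_R Σ L C(down) R.  That last total is Z_t 𝒲(P₅₆): P₅₆ joins the
-- two outer parts by a down-step, and when one of them is empty, the run of
-- down-steps that P₅₆ drops next to it contributes Z_t.

module Submission where

open import Defs
open import Algebra.Bundles using (CommutativeRing)
open import Data.Bool using (Bool; true; false; if_then_else_; not; _∨_; _∧_)
open import Data.Empty using (⊥-elim)
open import Data.List using (List; []; _∷_; foldr; concatMap)
open import Data.List.Relation.Unary.All as All using (All; []; _∷_)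
import Data.List.Relation.Unary.All.Properties as AllP
open import Data.Nat using (ℕ; zero; suc; _+_; _∸_; _≤_; _<_; z≤n; s≤s; z<s; _<ᵇ_; _≡ᵇ_; _≤ᵇ_)
import Data.Nat.Properties as ℕₚ
open ℕₚ using (≤-refl; ≤-reflexive; ≤-trans; ≤-antisym; ≤-pred; <-irrefl; <-trans; <-asym; <⇒≤; ≰⇒>; _≤?_;
             _≟_; ≤∧≢⇒<; n<1+n; n≤1+n; m≤m+n; m<m+n; m≤n⇒m≤1+n; m≤n⇒m<n∨m≡n; +-monoʳ-≤; +-monoʳ-<;
             +-suc; suc-injective; m+1+n≢m; +-cancelˡ-≡; +-∸-assoc; +-∸-comm; m+n∸m≡n; m+[n∸m]≡n; n∸n≡0;
             [m+n]∸[m+o]≡n∸o; m≤n⇒m∸n≡0; m∸n≡0⇒m≤n; m∸n≢0⇒n<m; 0≢1+n)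
open import Data.Product using (Σ; _×_; _,_; proj₁; proj₂)
open import Data.Sum using (_⊎_; inj₁; inj₂)
open import Function using (_∘_)
open import Relation.Binary.Construct.Closure.Transitive using ([_]; _∷_; _∷ʳ_)
open import Relation.Binary.PropositionalEquality
open import Relation.Nullary using (Dec; yes; no; does)

if-true : ∀ {a} {A : Set a} {b} {x y : A} → b ≡ true → (if b then x else y) ≡ x
if-true refl = refl

if-false : ∀ {a} {A : Set a} {b} {x y : A} → b ≡ false → (if b then x else y) ≡ y
if-false refl = refl

≡ᵇ-refl : ∀ n → (n ≡ᵇ n) ≡ true
≡ᵇ-refl zero    = refl
≡ᵇ-refl (suc n) = ≡ᵇ-refl n

≢⇒≡ᵇ-false : ∀ {m n} → m ≢ n → (m ≡ᵇ n) ≡ false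
≢⇒≡ᵇ-false {zero}  {zero}  m≢n = ⊥-elim (m≢n refl)
≢⇒≡ᵇ-false {zero}  {suc n} _   = refl
≢⇒≡ᵇ-false {suc m} {zero}  _   = refl
≢⇒≡ᵇ-false {suc m} {suc n} m≢n = ≢⇒≡ᵇ-false (m≢n ∘ cong suc)

<⇒<ᵇ-true : ∀ {m n} → m < n → (m <ᵇ n) ≡ true
<⇒<ᵇ-true {zero}  {suc n} _         = refl
<⇒<ᵇ-true {suc m} {suc n} (s≤s m<n) = <⇒<ᵇ-true m<n

≥⇒<ᵇ-false : ∀ {m n} → n ≤ m → (m <ᵇ n) ≡ false
≥⇒<ᵇ-false {m}     {zero}  _         = refl
≥⇒<ᵇ-false {suc m} {suc n} (s≤s n≤m) = ≥⇒<ᵇ-false n≤m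

≤⇒≤ᵇ-true : ∀ {m n} → m ≤ n → (m ≤ᵇ n) ≡ true
≤⇒≤ᵇ-true {zero}  _   = refl
≤⇒≤ᵇ-true {suc m} m<n = <⇒<ᵇ-true m<n

>⇒≤ᵇ-false : ∀ {m n} → n < m → (m ≤ᵇ n) ≡ false
>⇒≤ᵇ-false {suc m} (s≤s n≤m) = ≥⇒<ᵇ-false n≤m

≢false⇒≡true : ∀ {b} → b ≢ false → b ≡ true
≢false⇒≡true {true}  _   = refl
≢false⇒≡true {false} b≢f = ⊥-elim (b≢f refl)

≢true⇒≡false : ∀ {b} → b ≢ true → b ≡ false
≢true⇒≡false {false} _   = refl
≢true⇒≡false {true}  b≢t = ⊥-elim (b≢t refl)

∧-split : ∀ {a b} → a ∧ b ≡ true → a ≡ true × b ≡ true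
∧-split {true} {true} _ = refl , refl

module _ {x} {X : Set x} (F : Fence X) where

  Ascending Descending : ℕ → ℕ → Set
  Ascending  a b = a < b × (∀ i → a ≤ i → i < b → up F i ≡ true)
  Descending a b = b < a × (∀ i → b ≤ i → i < a → up F i ≡ false)

  lt⇒monotone : ∀ {a b} → a <[ F ] b → Ascending a b ⊎ Descending a b
  lt⇒monotone [ up-step {i} _ _ u ] =
    inj₁ (≤-refl , λ j i≤j j<1+i → subst (λ k → up F k ≡ true) (≤-antisym i≤j (≤-pred j<1+i)) u)
  lt⇒monotone [ down-step {i} _ _ u ] =
    inj₂ (≤-refl , λ j i≤j j<1+i → subst (λ k → up F k ≡ false) (≤-antisym i≤j (≤-pred j<1+i)) u)
  lt⇒monotone (up-step {i} _ _ u ∷ rest) with lt⇒monotone rest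
  ... | inj₁ (1+i<b , asc) = inj₁ (<-trans (n<1+n i) 1+i<b , extend)
    where
    extend : ∀ j → i ≤ j → j < _ → up F j ≡ true
    extend j i≤j j<b with i ≟ j
    ... | yes refl = u
    ... | no i≢j   = asc j (≤∧≢⇒< i≤j i≢j) j<b
  ... | inj₂ (b<1+i , desc) with trans (sym u) (desc i (≤-pred b<1+i) ≤-refl)
  ... | ()
  lt⇒monotone (down-step {i} _ _ u ∷ rest) with lt⇒monotone rest
  ... | inj₁ (i<b , asc) with trans (sym u) (asc i ≤-refl i<b)
  ... | ()
  lt⇒monotone (down-step {i} _ _ u ∷ rest) | inj₂ (b<i , desc) = inj₂ (<-trans b<i (n<1+n i) , extend)
    where
    extend : ∀ j → _ ≤ j → j < suc i → up F j ≡ false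
    extend j b≤j j<1+i with j ≟ i
    ... | yes refl = u
    ... | no j≢i   = desc j b≤j (≤∧≢⇒< (≤-pred j<1+i) j≢i)

  lt-ascending : ∀ {a b} → a <[ F ] b → a < b → ∀ i → a ≤ i → i < b → up F i ≡ true
  lt-ascending lt a<b with lt⇒monotone lt
  ... | inj₁ (_ , asc)  = asc
  ... | inj₂ (b<a , _)  = ⊥-elim (<-asym a<b b<a)

  lt-descending : ∀ {a b} → a <[ F ] b → b < a → ∀ i → b ≤ i → i < a → up F i ≡ false
  lt-descending lt b<a with lt⇒monotone lt
  ... | inj₁ (a<b , _)  = ⊥-elim (<-asym a<b b<a)
  ... | inj₂ (_ , desc) = desc

  lt-suc⇒up : ∀ {i} → i <[ F ] suc i → up F i ≡ true
  lt-suc⇒up lt = lt-ascending lt (n<1+n _) _ ≤-refl ≤-refl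

  suc-lt⇒down : ∀ {i} → suc i <[ F ] i → up F i ≡ false
  suc-lt⇒down lt = lt-descending lt (n<1+n _) _ ≤-refl ≤-refl

module _ {x} {X : Set x} (F : Fence X) where

  IsV⇒descending : ∀ {t v} → IsV F t v → ∀ k → suc (suc t + k) < v → up F (suc t + k) ≡ false
  IsV⇒descending {t} (_ , _ , below , _) k 2+t+k<v =
    lt-descending F (below _ (s≤s (s≤s (m≤m+n t k))) 2+t+k<v) (s≤s (s≤s (m≤m+n t k)))
      _ (m≤m+n (suc t) k) ≤-refl

  IsV⇒ascent : ∀ {t j} → IsV F t (suc (suc t + j)) → suc (suc t + j) ≤ len F → up F (suc t + j) ≡ true
  IsV⇒ascent {t} {j} (_ , _ , below , maximal) v≤h = ≢false⇒≡true λ down →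
    maximal v≤h (descend j below (down-step (s≤s z≤n) v≤h down))
    where
    descend : ∀ j → (∀ w → suc t < w → w < suc (suc t + j) → w <[ F ] suc t) →
              Cover F (suc (suc t + j)) (suc t + j) → suc (suc t + j) <[ F ] suc t
    descend zero    _     c = subst (λ w → suc (suc t + 0) <[ F ] w) (ℕₚ.+-identityʳ (suc t)) [ c ]
    descend (suc j) below c = c ∷ below (suc t + suc j) (m<m+n (suc t) z<s) ≤-refl

  IsU⇒descending : ∀ {a u} → IsU F (suc a) u → ∀ i → u < i → i < a → up F i ≡ false
  IsU⇒descending (_ , above , _) i u<i i<a = lt-descending F (above i u<i i<a) i<a i ≤-refl i<a

  IsU⇒ascent : ∀ {a u} → IsU F (suc a) u → a ≤ len F → 1 ≤ u → up F u ≡ true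
  IsU⇒ascent {a} {u} (u<a , above , maximal) a≤h 1≤u = ≢false⇒≡true λ down →
    maximal 1≤u (ascend (m≤n⇒m<n∨m≡n u<a) (down-step 1≤u (≤-trans u<a a≤h) down))
    where
    ascend : suc u < a ⊎ suc u ≡ a → Cover F (suc u) u → a <[ F ] u
    ascend (inj₁ 1+u<a) c = above (suc u) (n<1+n u) 1+u<a ∷ʳ c
    ascend (inj₂ refl)  c = [ c ]

module _ {x} {X : Set x} (F : Fence X) (a b : ℕ) where

  sub-up : ∀ k → up (sub F a b) (suc k) ≡ up F (a + k)
  sub-up k = cong (up F) (ℕₚ.+-comm k a)

  sub-el : ∀ k → el (sub F a b) (suc k) ≡ el F (a + k)
  sub-el k = cong (el F) (ℕₚ.+-comm k a)

module _ {x} {X : Set x} (Q Q′ : Fence X) where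

  ↘-up-left : ∀ {k} → k < len Q → up (Q ↘ Q′) k ≡ up Q k
  ↘-up-left k<n = if-true (<⇒<ᵇ-true k<n)

  ↘-up-join : up (Q ↘ Q′) (len Q) ≡ false
  ↘-up-join = trans (if-false (≥⇒<ᵇ-false {len Q} ≤-refl)) (if-true (≡ᵇ-refl (len Q)))

  ↘-up-right : ∀ k → up (Q ↘ Q′) (len Q + suc k) ≡ up Q′ (suc k)
  ↘-up-right k = trans (if-false (≥⇒<ᵇ-false (m≤m+n (len Q) (suc k))))
    (trans (if-false (≢⇒≡ᵇ-false (m+1+n≢m (len Q))))
           (cong (up Q′) (m+n∸m≡n (len Q) (suc k))))

  ↘-el-left : ∀ {k} → k ≤ len Q → el (Q ↘ Q′) k ≡ el Q k
  ↘-el-left k≤n = if-true (≤⇒≤ᵇ-true k≤n)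

  ↘-el-right : ∀ k → el (Q ↘ Q′) (len Q + suc k) ≡ el Q′ (suc k)
  ↘-el-right k = trans (if-false (>⇒≤ᵇ-false (m<m+n (len Q) z<s)))
    (cong (el Q′) (m+n∸m≡n (len Q) (suc k)))

-- In P₃₄ the block P[r, t] is read backwards: position r + k holds P(t - k).
mirror-index : ∀ r m k → k ≤ m → (r + m) + r ∸ (r + k) ≡ r + (m ∸ k)
mirror-index r m k k≤m = begin
  (r + m) + r ∸ (r + k)   ≡⟨ cong (_∸ (r + k)) (ℕₚ.+-assoc r m r) ⟩
  r + (m + r) ∸ (r + k)   ≡⟨ [m+n]∸[m+o]≡n∸o r (m + r) k ⟩
  (m + r) ∸ k             ≡⟨ +-∸-comm r k≤m ⟩
  (m ∸ k) + r             ≡⟨ ℕₚ.+-comm (m ∸ k) r ⟩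
  r + (m ∸ k)             ∎
  where open ≡-Reasoning

module _ {x} {X : Set x} (F : Fence X) (a m : ℕ) where
  private
    r t : ℕ
    r = suc a
    t = r + m
    F₃₄ : Fence X
    F₃₄ = P34 F r t

  P34-up-left : ∀ k → suc k < a → up F₃₄ (suc k) ≡ up F (suc k)
  P34-up-left k 1+k<a = if-true (<⇒<ᵇ-true (s≤s 1+k<a))

  P34-el-left : ∀ k → k < a → el F₃₄ (suc k) ≡ el F (suc k)
  P34-el-left k k<a = cong (el F) (if-true (<⇒<ᵇ-true (s≤s k<a)))

  P34-up-before : up F₃₄ a ≡ true
  P34-up-before = trans (if-false (≥⇒<ᵇ-false {r} ≤-refl)) (if-true (≡ᵇ-refl r))

  P34-up-middle : ∀ k → k < m → up F₃₄ (r + k) ≡ not (up F (r + (m ∸ suc k)))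
  P34-up-middle k k<m =
    trans (if-false (≥⇒<ᵇ-false (m≤n⇒m≤1+n (m≤m+n r k))))
    (trans (if-false (≢⇒≡ᵇ-false (λ 1+r+k≡r → <-irrefl (sym 1+r+k≡r) (s≤s (m≤m+n r k)))))
    (trans (if-true (<⇒<ᵇ-true (+-monoʳ-< r k<m)))
           (cong (not ∘ up F) (trans (cong (t + r ∸_) (sym (+-suc r k))) (mirror-index r m (suc k) k<m)))))

  P34-el-middle : ∀ k → k ≤ m → el F₃₄ (r + k) ≡ el F (r + (m ∸ k))
  P34-el-middle k k≤m = cong (el F)
    (trans (if-false (≥⇒<ᵇ-false (m≤m+n r k)))
    (trans (if-false (≥⇒<ᵇ-false (+-monoʳ-≤ r k≤m))) (mirror-index r m k k≤m)))

  P34-up-after : up F₃₄ t ≡ true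
  P34-up-after =
    trans (if-false (≥⇒<ᵇ-false (m≤n⇒m≤1+n (m≤m+n r m))))
    (trans (if-false (≢⇒≡ᵇ-false (λ 1+t≡r → <-irrefl (sym 1+t≡r) (s≤s (m≤m+n r m)))))
    (trans (if-false (≥⇒<ᵇ-false {t} ≤-refl)) (if-true (≡ᵇ-refl t))))

  P34-up-right : ∀ k → up F₃₄ (suc t + k) ≡ up F (suc t + k)
  P34-up-right k =
    trans (if-false (≥⇒<ᵇ-false (≤-trans r<2+t+k (n≤1+n _))))
    (trans (if-false (≢⇒≡ᵇ-false (λ 2+t+k≡r → <-irrefl (sym 2+t+k≡r) r<2+t+k)))
    (trans (if-false (≥⇒<ᵇ-false {suc t + k} {t} (<⇒≤ t<1+t+k)))
           (if-false (≢⇒≡ᵇ-false (λ 1+t+k≡t → <-irrefl (sym 1+t+k≡t) t<1+t+k)))))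
    where
    t<1+t+k : t < suc t + k
    t<1+t+k = m≤m+n (suc t) k
    r<2+t+k : r < suc (suc t + k)
    r<2+t+k = s≤s (≤-trans (m≤m+n r m) (≤-trans (n≤1+n t) t<1+t+k))

  P34-el-right : ∀ k → el F₃₄ (suc t + k) ≡ el F (suc t + k)
  P34-el-right k = cong (el F)
    (trans (if-false (≥⇒<ᵇ-false (≤-trans (m≤m+n r m) (≤-trans (n≤1+n t) (m≤m+n (suc t) k)))))
           (if-true (<⇒<ᵇ-true (m≤m+n (suc t) k))))

record Mat₂ {a} (A : Set a) : Set a where
  constructor mat
  field
    m11 m12 m21 m22 : A
open Mat₂ public

-- Parameterised by the operations so that it can be instantiated both in
-- the ring and in the polynomial syntax of the ring solver.
module MatrixOps {a} {A : Set a} (0ₐ 1ₐ : A) (_⊕_ _⊛_ : A → A → A) where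

  infixl 7 _⊠_
  _⊠_ : Mat₂ A → Mat₂ A → Mat₂ A
  mat a b c d ⊠ mat e f g h =
    mat ((a ⊛ e) ⊕ (b ⊛ g)) ((a ⊛ f) ⊕ (b ⊛ h)) ((c ⊛ e) ⊕ (d ⊛ g)) ((c ⊛ f) ⊕ (d ⊛ h))

  _ᵀ : Mat₂ A → Mat₂ A
  mat a b c d ᵀ = mat a c b d

  idMat : Mat₂ A
  idMat = mat 1ₐ 0ₐ 0ₐ 1ₐ

  conj : Mat₂ A → Mat₂ A → Mat₂ A
  conj Z S = S ᵀ ⊠ (Z ⊠ S)

  -- Rows and columns are indexed by (in the ideal, not in the ideal); an
  -- up-step P(i) < P(i+1) forbids  i ∉ I, i+1 ∈ I,  a down-step the converse.
  stepMat : Bool → Mat₂ A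
  stepMat true  = mat 1ₐ 1ₐ 0ₐ 1ₐ
  stepMat false = mat 1ₐ 0ₐ 1ₐ 1ₐ

  weightMat : A → Mat₂ A
  weightMat w = mat w 0ₐ 0ₐ 1ₐ

  column₁ column₂ total : Mat₂ A → A
  column₁ M = m11 M ⊕ m21 M
  column₂ M = m12 M ⊕ m22 M
  total M = column₁ M ⊕ column₂ M

  -- stand-ins for an empty left / right part of a fence
  leftEnd rightEnd : Mat₂ A
  leftEnd  = mat 1ₐ 0ₐ 0ₐ 0ₐ
  rightEnd = mat 0ₐ 0ₐ 0ₐ 1ₐ

module _ {c ℓ} (R : CommutativeRing c ℓ) where

  open CommutativeRing R
    using (Carrier; _≈_; 0#; 1#; +-cong; *-cong; +-congˡ; +-congʳ; *-congˡ; *-congʳ;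
           +-assoc; *-assoc; *-comm; +-identityˡ; +-identityʳ; *-identityˡ; *-identityʳ;
           zeroʳ; distribˡ; commutativeSemiring)
    renaming (_+_ to _+ᵣ_; _*_ to _*ᵣ_; refl to ≈-refl; sym to ≈-sym; trans to ≈-trans;
              reflexive to ≈-reflexive)
  open WithRing R
  open import Relation.Binary.Reasoning.Setoid (CommutativeRing.setoid R) as ≈-Reasoning using ()
  open import Algebra.Solver.Ring.NaturalCoefficients.Default commutativeSemiring
    using (solve; _:=_; _:+_; _:*_; con; Polynomial)

  prodFrom : (ℕ → Carrier) → ℕ → ℕ → Carrier
  prodFrom f zero    i = 1#
  prodFrom f (suc n) i = f i *ᵣ prodFrom f n (suc i)

  prodFrom-snoc : ∀ f n i → prodFrom f (suc n) i ≈ prodFrom f n i *ᵣ f (i + n)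
  prodFrom-snoc f zero    i = ≈-trans (*-comm _ _) (*-congˡ (≈-reflexive (cong f (sym (ℕₚ.+-identityʳ i)))))
  prodFrom-snoc f (suc n) i = ≈-trans (*-congˡ (prodFrom-snoc f n (suc i)))
    (≈-trans (≈-sym (*-assoc _ _ _)) (*-congˡ (≈-reflexive (cong f (sym (+-suc i n))))))

  prodFrom-cong : ∀ {f g} n i → (∀ k → i ≤ k → k < i + n → f k ≈ g k) → prodFrom f n i ≈ prodFrom g n i
  prodFrom-cong zero    i f≈g = ≈-refl
  prodFrom-cong (suc n) i f≈g = *-cong (f≈g i ≤-refl (m<m+n i z<s))
    (prodFrom-cong n (suc i) λ k i<k k<i+1+n → f≈g k (<⇒≤ i<k) (subst (k <_) (sym (+-suc i n)) k<i+1+n))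

  -- prodRange hides its length  suc b ∸ a  in a local function; `with` abstracts it
  -- in the unfolded goal.
  prodRange-step : ∀ f {a b} → a ≤ b → prodRange f a b ≡ f a *ᵣ prodRange f (suc a) b
  prodRange-step f {a} {b} a≤b with suc b ∸ a | +-∸-assoc 1 a≤b
  ... | .(suc (b ∸ a)) | refl = refl

  prodRange-empty : ∀ f {a b} → b < a → prodRange f a b ≡ 1#
  prodRange-empty f {a} {b} b<a with suc b ∸ a | m≤n⇒m∸n≡0 b<a
  ... | .0 | refl = refl

  prodRange≡prodFrom : ∀ f a b → prodRange f a b ≡ prodFrom f (suc b ∸ a) a
  prodRange≡prodFrom f a b = by-length (suc b ∸ a) a refl
    where
    by-length : ∀ n a → suc b ∸ a ≡ n → prodRange f a b ≡ prodFrom f n a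
    by-length zero    a len≡0   = prodRange-empty f {a} {b} (m∸n≡0⇒m≤n len≡0)
    by-length (suc n) a len≡1+n = trans (prodRange-step f {a} {b} a≤b)
        (cong (f a *ᵣ_) (by-length n (suc a) (suc-injective (trans (sym (+-∸-assoc 1 a≤b)) len≡1+n))))
      where
      a≤b : a ≤ b
      a≤b = ≤-pred (m∸n≢0⇒n<m (λ len≡0 → 0≢1+n (trans (sym len≡0) len≡1+n)))

  -- Transfer matrices

  open MatrixOps 0# 1# _+ᵣ_ _*ᵣ_
  module Poly {n : ℕ} = MatrixOps {A = Polynomial n} (con 0) (con 1) _:+_ _:*_

  Mat : Set c
  Mat = Mat₂ Carrier

  infix 4 _≋_
  record _≋_ (A B : Mat) : Set ℓ where
    constructor mk≋
    field
      ≋11 : m11 A ≈ m11 B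
      ≋12 : m12 A ≈ m12 B
      ≋21 : m21 A ≈ m21 B
      ≋22 : m22 A ≈ m22 B
  open _≋_

  ≋-refl : ∀ {A} → A ≋ A
  ≋-refl = mk≋ ≈-refl ≈-refl ≈-refl ≈-refl

  ≋-reflexive : ∀ {A B} → A ≡ B → A ≋ B
  ≋-reflexive refl = ≋-refl

  ≋-sym : ∀ {A B} → A ≋ B → B ≋ A
  ≋-sym (mk≋ p q r s) = mk≋ (≈-sym p) (≈-sym q) (≈-sym r) (≈-sym s)

  ≋-trans : ∀ {A B C} → A ≋ B → B ≋ C → A ≋ C
  ≋-trans (mk≋ p q r s) (mk≋ p′ q′ r′ s′) =
    mk≋ (≈-trans p p′) (≈-trans q q′) (≈-trans r r′) (≈-trans s s′)

  ⊠-cong : ∀ {A A′ B B′} → A ≋ A′ → B ≋ B′ → A ⊠ B ≋ A′ ⊠ B′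
  ⊠-cong {mat _ _ _ _} {mat _ _ _ _} {mat _ _ _ _} {mat _ _ _ _} (mk≋ a b c d) (mk≋ e f g h) =
    mk≋ (+-cong (*-cong a e) (*-cong b g)) (+-cong (*-cong a f) (*-cong b h))
        (+-cong (*-cong c e) (*-cong d g)) (+-cong (*-cong c f) (*-cong d h))

  ⊠-congˡ : ∀ {A B B′} → B ≋ B′ → A ⊠ B ≋ A ⊠ B′
  ⊠-congˡ = ⊠-cong ≋-refl

  ⊠-congʳ : ∀ {A A′ B} → A ≋ A′ → A ⊠ B ≋ A′ ⊠ B
  ⊠-congʳ A≋A′ = ⊠-cong A≋A′ ≋-refl

  ⊠-assoc : ∀ A B C → (A ⊠ B) ⊠ C ≋ A ⊠ (B ⊠ C)
  ⊠-assoc (mat a b c d) (mat e f g h) (mat i j k l) =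
    mk≋ (entry a b e f g h i k) (entry a b e f g h j l) (entry c d e f g h i k) (entry c d e f g h j l)
    where
    entry : ∀ x y e f g h z w → (x *ᵣ e +ᵣ y *ᵣ g) *ᵣ z +ᵣ (x *ᵣ f +ᵣ y *ᵣ h) *ᵣ w
                               ≈ x *ᵣ (e *ᵣ z +ᵣ f *ᵣ w) +ᵣ y *ᵣ (g *ᵣ z +ᵣ h *ᵣ w)
    entry = solve 8 (λ x y e f g h z w → (x :* e :+ y :* g) :* z :+ (x :* f :+ y :* h) :* w
                                         := x :* (e :* z :+ f :* w) :+ y :* (g :* z :+ h :* w)) ≈-refl

  ⊠-identityˡ : ∀ A → idMat ⊠ A ≋ A
  ⊠-identityˡ (mat a b c d) = mk≋ (left a c) (left b d) (right a c) (right b d)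
    where
    left : ∀ x y → 1# *ᵣ x +ᵣ 0# *ᵣ y ≈ x
    left = solve 2 (λ x y → con 1 :* x :+ con 0 :* y := x) ≈-refl
    right : ∀ x y → 0# *ᵣ x +ᵣ 1# *ᵣ y ≈ y
    right = solve 2 (λ x y → con 0 :* x :+ con 1 :* y := y) ≈-refl

  ⊠-identityʳ : ∀ A → A ⊠ idMat ≋ A
  ⊠-identityʳ (mat a b c d) = mk≋ (left a b) (right a b) (left c d) (right c d)
    where
    left : ∀ x y → x *ᵣ 1# +ᵣ y *ᵣ 0# ≈ x
    left = solve 2 (λ x y → x :* con 1 :+ y :* con 0 := x) ≈-refl
    right : ∀ x y → x *ᵣ 0# +ᵣ y *ᵣ 1# ≈ y
    right = solve 2 (λ x y → x :* con 0 :+ y :* con 1 := y) ≈-refl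

  ᵀ-cong : ∀ {A B} → A ≋ B → A ᵀ ≋ B ᵀ
  ᵀ-cong {mat _ _ _ _} {mat _ _ _ _} (mk≋ p q r s) = mk≋ p r q s

  ᵀ-⊠ : ∀ A B → (A ⊠ B) ᵀ ≋ B ᵀ ⊠ A ᵀ
  ᵀ-⊠ (mat a b c d) (mat e f g h) = mk≋ (swap a e b g) (swap c e d g) (swap a f b h) (swap c f d h)
    where
    swap : ∀ w x y z → w *ᵣ x +ᵣ y *ᵣ z ≈ x *ᵣ w +ᵣ z *ᵣ y
    swap w x y z = +-cong (*-comm w x) (*-comm y z)

  stepMat-ᵀ : ∀ b → stepMat b ᵀ ≡ stepMat (not b)
  stepMat-ᵀ true  = refl
  stepMat-ᵀ false = refl

  weightMat-cong : ∀ {x y} → x ≈ y → weightMat x ≋ weightMat y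
  weightMat-cong x≈y = mk≋ x≈y ≈-refl ≈-refl ≈-refl

  column₁-cong : ∀ {A B} → A ≋ B → column₁ A ≈ column₁ B
  column₁-cong A≋B = +-cong (≋11 A≋B) (≋21 A≋B)

  column₂-cong : ∀ {A B} → A ≋ B → column₂ A ≈ column₂ B
  column₂-cong A≋B = +-cong (≋12 A≋B) (≋22 A≋B)

  total-cong : ∀ {A B} → A ≋ B → total A ≈ total B
  total-cong A≋B = +-cong (column₁-cong A≋B) (column₂-cong A≋B)

  steps : (ℕ → Bool) → (ℕ → Carrier) → ℕ → ℕ → Mat
  steps u e a zero    = idMat
  steps u e a (suc m) = stepMat (u a) ⊠ (weightMat (e (suc a)) ⊠ steps u e (suc a) m)

  -- the positions a, a + 1, …, a + m
  segment : (ℕ → Bool) → (ℕ → Carrier) → ℕ → ℕ → Mat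
  segment u e a m = weightMat (e a) ⊠ steps u e a m

  steps-++ : ∀ u e a m n → steps u e a (m + n) ≋ steps u e a m ⊠ steps u e (a + m) n
  steps-++ u e a zero    n rewrite ℕₚ.+-identityʳ a = ≋-sym (⊠-identityˡ _)
  steps-++ u e a (suc m) n rewrite +-suc a m =
    ≋-trans (⊠-congˡ (⊠-congˡ (steps-++ u e (suc a) m n)))
      (≋-trans (⊠-congˡ (≋-sym (⊠-assoc _ _ _))) (≋-sym (⊠-assoc _ _ _)))

  segment-split : ∀ u e a m n →
    segment u e a (m + suc n) ≋ segment u e a m ⊠ (stepMat (u (a + m)) ⊠ segment u e (suc (a + m)) n)
  segment-split u e a m n = ≋-trans (⊠-congˡ (steps-++ u e a m (suc n))) (≋-sym (⊠-assoc _ _ _))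

  steps-snoc : ∀ u e a m →
    steps u e a (suc m) ≋ steps u e a m ⊠ (stepMat (u (a + m)) ⊠ weightMat (e (suc (a + m))))
  steps-snoc u e a m = ≋-trans (≋-reflexive (cong (steps u e a) (ℕₚ.+-comm 1 m)))
    (≋-trans (steps-++ u e a m 1) (⊠-congˡ (⊠-congˡ (⊠-identityʳ _))))

  segment-snoc : ∀ u e a m →
    segment u e a (suc m) ≋ segment u e a m ⊠ (stepMat (u (a + m)) ⊠ weightMat (e (suc (a + m))))
  segment-snoc u e a m = ≋-trans (⊠-congˡ (steps-snoc u e a m)) (≋-sym (⊠-assoc _ _ _))

  segment-cong : ∀ u₁ e₁ u₂ e₂ a b m →
    (∀ k → k < m → u₁ (a + k) ≡ u₂ (b + k)) →
    (∀ k → k ≤ m → e₁ (a + k) ≈ e₂ (b + k)) →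
    segment u₁ e₁ a m ≋ segment u₂ e₂ b m
  segment-cong u₁ e₁ u₂ e₂ a b m u≡ e≈ = ⊠-cong (weightMat-cong first) (rest m u≡ e≈)
    where
    first : e₁ a ≈ e₂ b
    first = subst₂ (λ x y → e₁ x ≈ e₂ y) (ℕₚ.+-identityʳ a) (ℕₚ.+-identityʳ b) (e≈ 0 z≤n)
    rest : ∀ m → (∀ k → k < m → u₁ (a + k) ≡ u₂ (b + k)) →
           (∀ k → k ≤ m → e₁ (a + k) ≈ e₂ (b + k)) → steps u₁ e₁ a m ≋ steps u₂ e₂ b m
    rest zero    _  _  = ≋-refl
    rest (suc m) u≡ e≈ =
      ⊠-cong (≋-reflexive (cong stepMat
               (subst₂ (λ x y → u₁ x ≡ u₂ y) (ℕₚ.+-identityʳ a) (ℕₚ.+-identityʳ b) (u≡ 0 z<s))))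
        (segment-cong u₁ e₁ u₂ e₂ (suc a) (suc b) m
          (λ k k<m → subst₂ (λ x y → u₁ x ≡ u₂ y) (+-suc a k) (+-suc b k) (u≡ (suc k) (s≤s k<m)))
          (λ k k≤m → subst₂ (λ x y → e₁ x ≈ e₂ y) (+-suc a k) (+-suc b k) (e≈ (suc k) (s≤s k≤m))))

  -- Reading a segment backwards transposes its transfer matrix; the weight of
  -- its last position a + m is left unconstrained.
  segment-reverse : ∀ u₁ e₁ u₂ e₂ a b m →
    (∀ k → k < m → u₁ (a + k) ≡ not (u₂ (b + (m ∸ suc k)))) →
    (∀ k → k < m → e₁ (a + k) ≈ e₂ (b + (m ∸ k))) →
    segment u₁ e₁ a m ≋ (weightMat (e₁ (a + m)) ⊠ steps u₂ e₂ b m) ᵀ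
  segment-reverse u₁ e₁ u₂ e₂ a b zero u≡ e≈ =
    ≋-trans (⊠-identityʳ _) (≋-trans (≋-reflexive (cong (weightMat ∘ e₁) (sym (ℕₚ.+-identityʳ a))))
      (ᵀ-cong (≋-sym (⊠-identityʳ _))))
  segment-reverse u₁ e₁ u₂ e₂ a b (suc m) u≡ e≈ =
    ≋-trans (⊠-congˡ (⊠-congˡ reversed-rest))
      (≋-trans (≋-sym (⊠-assoc _ _ _))
      (≋-trans (⊠-congʳ (⊠-cong (weightMat-cong first-weight)
                                 (≋-reflexive (trans (cong stepMat first-step) (sym (stepMat-ᵀ (u₂ (b + m))))))))
      (≋-trans (⊠-congʳ (≋-sym (ᵀ-⊠ _ _)))
      (≋-trans (≋-sym (ᵀ-⊠ _ _))
      (ᵀ-cong (≋-trans (⊠-assoc _ _ _)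
                (⊠-congˡ (≋-sym (steps-snoc u₂ e₂ b m)))))))))
    where
    reversed-rest : segment u₁ e₁ (suc a) m ≋ (weightMat (e₁ (a + suc m)) ⊠ steps u₂ e₂ b m) ᵀ
    reversed-rest = ≋-trans (segment-reverse u₁ e₁ u₂ e₂ (suc a) b m
        (λ k k<m → subst (λ x → u₁ x ≡ not (u₂ (b + (m ∸ suc k)))) (+-suc a k) (u≡ (suc k) (s≤s k<m)))
        (λ k k<m → subst (λ x → e₁ x ≈ e₂ (b + (m ∸ k))) (+-suc a k) (e≈ (suc k) (s≤s k<m))))
      (≋-reflexive (cong (λ x → (weightMat (e₁ x) ⊠ steps u₂ e₂ b m) ᵀ) (sym (+-suc a m))))
    first-weight : e₁ a ≈ e₂ (suc (b + m))
    first-weight = subst₂ (λ x y → e₁ x ≈ e₂ y) (ℕₚ.+-identityʳ a) (+-suc b m) (e≈ 0 z<s)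
    first-step : u₁ a ≡ not (u₂ (b + m))
    first-step = subst (λ x → u₁ x ≡ not (u₂ (b + m))) (ℕₚ.+-identityʳ a) (u≡ 0 z<s)

  Subset : Set
  Subset = ℕ → Bool

  sumOver : List Subset → (Subset → Carrier) → Carrier
  sumOver xs g = foldr (λ S acc → g S +ᵣ acc) 0# xs

  sumOver-cong : ∀ {xs g h} → All (λ S → g S ≈ h S) xs → sumOver xs g ≈ sumOver xs h
  sumOver-cong []         = ≈-refl
  sumOver-cong (g≈h ∷ gs) = +-cong g≈h (sumOver-cong gs)

  sumOver-+ : ∀ xs g h → sumOver xs (λ S → g S +ᵣ h S) ≈ sumOver xs g +ᵣ sumOver xs h
  sumOver-+ []       g h = ≈-sym (+-identityʳ 0#)
  sumOver-+ (S ∷ xs) g h = ≈-trans (+-congˡ (sumOver-+ xs g h)) (interchange _ _ _ _)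
    where
    interchange : ∀ a b c d → (a +ᵣ b) +ᵣ (c +ᵣ d) ≈ (a +ᵣ c) +ᵣ (b +ᵣ d)
    interchange = solve 4 (λ a b c d → (a :+ b) :+ (c :+ d) := (a :+ c) :+ (b :+ d)) ≈-refl

  sumOver-*ˡ : ∀ xs x g → sumOver xs (λ S → x *ᵣ g S) ≈ x *ᵣ sumOver xs g
  sumOver-*ˡ []       x g = ≈-sym (zeroʳ x)
  sumOver-*ˡ (S ∷ xs) x g = ≈-trans (+-congˡ (sumOver-*ˡ xs x g)) (≈-sym (distribˡ x _ _))

  sumOver-pairs : ∀ xs (e : Subset → Subset) g →
    sumOver (concatMap (λ S → S ∷ e S ∷ []) xs) g ≈ sumOver xs (λ S → g S +ᵣ g (e S))
  sumOver-pairs []       e g = ≈-refl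
  sumOver-pairs (S ∷ xs) e g = ≈-trans (+-congˡ (+-congˡ (sumOver-pairs xs e g))) (≈-sym (+-assoc _ _ _))

  -- subsets (suc n) lists each S ∈ subsets n followed by  insert n S = S ∪ {n + 1}
  insert : ℕ → Subset → Subset
  insert n S k = if k ≡ᵇ suc n then true else S k

  insert-new : ∀ n S → insert n S (suc n) ≡ true
  insert-new n S = if-true (≡ᵇ-refl (suc n))

  insert-old : ∀ n S {k} → k ≤ n → insert n S k ≡ S k
  insert-old n S {k} k≤n = if-false (≢⇒≡ᵇ-false {k} {suc n} (λ { refl → <-irrefl refl (s≤s k≤n) }))

  BoundedBy : ℕ → Subset → Set
  BoundedBy n S = ∀ k → n < k → S k ≡ false

  subsets-bounded : ∀ n → All (BoundedBy n) (subsets n)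
  subsets-bounded zero    = (λ _ _ → refl) ∷ []
  subsets-bounded (suc n) = AllP.concat⁺ (AllP.map⁺ (All.map both (subsets-bounded n)))
    where
    both : ∀ {S} → BoundedBy n S → All (BoundedBy (suc n)) (S ∷ insert n S ∷ [])
    both S⊆ = (λ k 1+n<k → S⊆ k (<-trans (n<1+n n) 1+n<k))
            ∷ (λ k 1+n<k → trans (if-false (≢⇒≡ᵇ-false {k} {suc n} (λ { refl → <-irrefl refl 1+n<k })))
                                  (S⊆ k (<-trans (n<1+n n) 1+n<k)))
            ∷ []

  -- 𝒲 as a product of transfer matrices

  column₁-step : ∀ A u w → column₁ (A ⊠ (stepMat u ⊠ weightMat w)) ≈ w *ᵣ (if u then column₁ A else total A)
  column₁-step (mat a b c d) true  w = solve 5 (λ a b c d w →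
    Poly.column₁ (mat a b c d Poly.⊠ (Poly.stepMat true Poly.⊠ Poly.weightMat w)) := w :* Poly.column₁ (mat a b c d))
    ≈-refl a b c d w
  column₁-step (mat a b c d) false w = solve 5 (λ a b c d w →
    Poly.column₁ (mat a b c d Poly.⊠ (Poly.stepMat false Poly.⊠ Poly.weightMat w)) := w :* Poly.total (mat a b c d))
    ≈-refl a b c d w

  column₂-step : ∀ A u w → column₂ (A ⊠ (stepMat u ⊠ weightMat w)) ≈ (if u then total A else column₂ A)
  column₂-step (mat a b c d) true  w = solve 5 (λ a b c d w →
    Poly.column₂ (mat a b c d Poly.⊠ (Poly.stepMat true Poly.⊠ Poly.weightMat w)) := Poly.total (mat a b c d))
    ≈-refl a b c d w
  column₂-step (mat a b c d) false w = solve 5 (λ a b c d w →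
    Poly.column₂ (mat a b c d Poly.⊠ (Poly.stepMat false Poly.⊠ Poly.weightMat w)) := Poly.column₂ (mat a b c d))
    ≈-refl a b c d w

  gate : Bool → Carrier → Carrier
  gate b x = if b then x else 0#

  gate-cong : ∀ {b b′ x x′} → b ≡ b′ → x ≈ x′ → gate b x ≈ gate b′ x′
  gate-cong {true}  refl x≈x′ = x≈x′
  gate-cong {false} refl _    = ≈-refl

  gate-into : ∀ u b g x w →
    gate (g ∧ (if u then b else true)) (x *ᵣ w) ≈ w *ᵣ (if u then gate b (gate g x) else gate g x)
  gate-into true  true  true  x w = *-comm x w
  gate-into false _     true  x w = *-comm x w
  gate-into true  false true  x w = ≈-sym (zeroʳ w)
  gate-into true  true  false x w = ≈-sym (zeroʳ w)
  gate-into true  false false x w = ≈-sym (zeroʳ w)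
  gate-into false _     false x w = ≈-sym (zeroʳ w)

  gate-outof : ∀ u b g x →
    gate (g ∧ (if u then true else not b)) (x *ᵣ 1#) ≈ (if u then gate g x else gate (not b) (gate g x))
  gate-outof true  _     true  x = *-identityʳ x
  gate-outof false false true  x = *-identityʳ x
  gate-outof false true  true  x = ≈-refl
  gate-outof true  _     false x = ≈-refl
  gate-outof false true  false x = ≈-refl
  gate-outof false false false x = ≈-refl

  transferWeight : ℕ → (ℕ → Bool) → (ℕ → Carrier) → Carrier
  transferWeight zero    u e = 1#
  transferWeight (suc m) u e = total (segment u e 1 m)

  module _ (F : Fence Carrier) where

    isIdealUpTo : ℕ → Subset → Bool
    isIdealUpTo zero          S = true
    isIdealUpTo (suc zero)    S = true
    isIdealUpTo (suc (suc n)) S = isIdealUpTo (suc n) S ∧ coverOK F S (suc n)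

    CoversOK : ℕ → Subset → Set
    CoversOK n S = ∀ i → i < n → 1 ≤ i → coverOK F S i ≡ true

    isIdealUpTo⇒coversOK : ∀ n S → isIdealUpTo n S ≡ true → CoversOK n S
    isIdealUpTo⇒coversOK zero          S ok i ()
    isIdealUpTo⇒coversOK (suc zero)    S ok (suc i) (s≤s ())
    isIdealUpTo⇒coversOK (suc (suc n)) S ok i i<2+n 1≤i =
      extend (isIdealUpTo⇒coversOK (suc n) S (proj₁ (∧-split {isIdealUpTo (suc n) S} ok))) (i ≟ suc n)
      where
      extend : CoversOK (suc n) S → Dec (i ≡ suc n) → coverOK F S i ≡ true
      extend _       (yes refl)  = proj₂ (∧-split {isIdealUpTo (suc n) S} ok)
      extend earlier (no i≢1+n) = earlier i (≤∧≢⇒< (≤-pred i<2+n) i≢1+n) 1≤i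

    coversOK⇒isIdealUpTo : ∀ n S → CoversOK n S → isIdealUpTo n S ≡ true
    coversOK⇒isIdealUpTo zero          S ok = refl
    coversOK⇒isIdealUpTo (suc zero)    S ok = refl
    coversOK⇒isIdealUpTo (suc (suc n)) S ok
      rewrite coversOK⇒isIdealUpTo (suc n) S (λ i i<1+n → ok i (<-trans i<1+n (n<1+n _)))
            | ok (suc n) ≤-refl (s≤s z≤n) = refl

    coversOK⇒isOrderIdeal : ∀ S → CoversOK (len F) S → IsOrderIdeal F S
    coversOK⇒isOrderIdeal S ok [ c ]    Sb = cover c Sb
      where
      cover : ∀ {a b} → Cover F a b → S b ≡ true → S a ≡ true
      cover (up-step {i} 1≤i i<h u) Sb with ok i i<h 1≤i
      ... | c rewrite u | Sb with S i
      ... | true = refl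
      cover (down-step {i} 1≤i i<h u) Sb with ok i i<h 1≤i
      ... | c rewrite u | Sb with S (suc i)
      ... | true = refl
    coversOK⇒isOrderIdeal S ok (c ∷ cs) Sz = coversOK⇒isOrderIdeal S ok [ c ] (coversOK⇒isOrderIdeal S ok cs Sz)

    isOrderIdeal⇒coversOK : ∀ S → IsOrderIdeal F S → CoversOK (len F) S
    isOrderIdeal⇒coversOK S I i i<h 1≤i with up F i in u
    ... | true with S (suc i) in Si+1
    ...   | false = refl
    ...   | true rewrite I [ up-step 1≤i i<h u ] Si+1 = refl
    isOrderIdeal⇒coversOK S I i i<h 1≤i | false with S i in Si
    ...   | false = refl
    ...   | true rewrite I [ down-step 1≤i i<h u ] Si = refl

    does-isOrderIdeal? : ∀ S → does (isOrderIdeal? F S) ≡ isIdealUpTo (len F) S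
    does-isOrderIdeal? S with isOrderIdeal? F S | isIdealUpTo (len F) S in ideal
    ... | yes I | true  = refl
    ... | yes I | false = sym (trans (sym ideal) (coversOK⇒isIdealUpTo (len F) S (isOrderIdeal⇒coversOK S I)))
    ... | no ¬I | true  = ⊥-elim (¬I (coversOK⇒isOrderIdeal S (isIdealUpTo⇒coversOK (len F) S ideal)))
    ... | no ¬I | false = refl

    weightOf : Subset → ℕ → Carrier
    weightOf S i = if S i then el F i else 1#

    term : ℕ → Subset → Carrier
    term n S = gate (isIdealUpTo n S) (prodFrom (weightOf S) n 1)

    W≈sum-terms : W F ≈ sumOver (subsets (len F)) (term (len F))
    W≈sum-terms = sumOver-cong {xs = subsets (len F)} (All.tabulate λ {S} _ → pointwise S)
      where
      pointwise : ∀ S → (if does (isOrderIdeal? F S) then prodRange (weightOf S) 1 (len F) else 0#)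
                        ≈ term (len F) S
      pointwise S rewrite does-isOrderIdeal? S with isIdealUpTo (len F) S
      ... | true  = ≈-reflexive (prodRange≡prodFrom (weightOf S) 1 (len F))
      ... | false = ≈-refl

    -- The ideal sum of P[1, n] split by whether n is in the ideal: these are the
    -- column sums of the transfer matrix of P[1, n].
    weightIn weightOut : ℕ → Carrier
    weightIn  n = sumOver (subsets n) (λ S → gate (S n) (term n S))
    weightOut n = sumOver (subsets n) (λ S → gate (not (S n)) (term n S))

    sum-terms≈in+out : ∀ n → sumOver (subsets n) (term n) ≈ weightIn n +ᵣ weightOut n
    sum-terms≈in+out n =
      ≈-trans (sumOver-cong {xs = subsets n} (All.tabulate λ {S} _ → split S)) (sumOver-+ (subsets n) _ _)
      where
      split : ∀ S → term n S ≈ gate (S n) (term n S) +ᵣ gate (not (S n)) (term n S)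
      split S with S n
      ... | true  = ≈-sym (+-identityʳ _)
      ... | false = ≈-sym (+-identityˡ _)

    isIdealUpTo-local : ∀ n S S′ → (∀ k → k ≤ n → S k ≡ S′ k) → isIdealUpTo n S ≡ isIdealUpTo n S′
    isIdealUpTo-local zero          S S′ S≡S′ = refl
    isIdealUpTo-local (suc zero)    S S′ S≡S′ = refl
    isIdealUpTo-local (suc (suc n)) S S′ S≡S′ =
      cong₂ _∧_ (isIdealUpTo-local (suc n) S S′ λ k k≤1+n → S≡S′ k (m≤n⇒m≤1+n k≤1+n))
        (cong₂ (λ a b → if up F (suc n) then not b ∨ a else not a ∨ b)
          (S≡S′ (suc n) (n≤1+n _)) (S≡S′ (suc (suc n)) ≤-refl))

    weightOf-local : ∀ n S S′ → (∀ k → k ≤ n → S k ≡ S′ k) →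
                     prodFrom (weightOf S) n 1 ≈ prodFrom (weightOf S′) n 1
    weightOf-local n S S′ S≡S′ = prodFrom-cong n 1 λ k _ k<1+n →
      ≈-reflexive (cong (λ b → if b then el F k else 1#) (S≡S′ k (≤-pred k<1+n)))

    coverOK-into : ∀ S i → S (suc i) ≡ true → coverOK F S i ≡ (if up F i then S i else true)
    coverOK-into S i Si+1 rewrite Si+1 with up F i | S i
    ... | true  | _     = refl
    ... | false | true  = refl
    ... | false | false = refl

    coverOK-outof : ∀ S i → S (suc i) ≡ false → coverOK F S i ≡ (if up F i then true else not (S i))
    coverOK-outof S i Si+1 rewrite Si+1 with up F i | S i
    ... | true  | _     = refl
    ... | false | true  = refl
    ... | false | false = refl

    module _ (m : ℕ) where
      private
        N : ℕ
        N = suc m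

      term-insert : ∀ S → term (suc N) (insert N S) ≈
        el F (suc N) *ᵣ (if up F N then gate (S N) (term N S) else term N S)
      term-insert S = ≈-trans (gate-cong ideal weight) (gate-into (up F N) (S N) (isIdealUpTo N S) _ _)
        where
        agree : ∀ k → k ≤ N → insert N S k ≡ S k
        agree k = insert-old N S
        ideal : isIdealUpTo (suc N) (insert N S) ≡ isIdealUpTo N S ∧ (if up F N then S N else true)
        ideal = cong₂ _∧_ (isIdealUpTo-local N _ S agree)
          (trans (coverOK-into (insert N S) N (insert-new N S))
                 (cong (λ b → if up F N then b else true) (insert-old N S ≤-refl)))
        weight : prodFrom (weightOf (insert N S)) (suc N) 1 ≈ prodFrom (weightOf S) N 1 *ᵣ el F (suc N)
        weight = ≈-trans (prodFrom-snoc (weightOf (insert N S)) N 1)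
          (*-cong (weightOf-local N _ S agree)
                  (≈-reflexive (cong (λ b → if b then el F (suc N) else 1#) (insert-new N S))))

      term-keep : ∀ S → BoundedBy N S →
        term (suc N) S ≈ (if up F N then term N S else gate (not (S N)) (term N S))
      term-keep S S⊆ = ≈-trans (gate-cong ideal weight) (gate-outof (up F N) (S N) (isIdealUpTo N S) _)
        where
        ideal : isIdealUpTo (suc N) S ≡ isIdealUpTo N S ∧ (if up F N then true else not (S N))
        ideal = cong (isIdealUpTo N S ∧_) (coverOK-outof S N (S⊆ (suc N) ≤-refl))
        weight : prodFrom (weightOf S) (suc N) 1 ≈ prodFrom (weightOf S) N 1 *ᵣ 1#
        weight = ≈-trans (prodFrom-snoc (weightOf S) N 1)
          (*-congˡ (≈-reflexive (cong (λ b → if b then el F (suc N) else 1#) (S⊆ (suc N) ≤-refl))))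

      weightIn-step : weightIn (suc N) ≈ el F (suc N) *ᵣ (if up F N then weightIn N else weightIn N +ᵣ weightOut N)
      weightIn-step = ≈-trans (sumOver-pairs (subsets N) (insert N) _)
        (≈-trans (sumOver-cong (All.map pointwise (subsets-bounded N)))
        (≈-trans (sumOver-*ˡ (subsets N) _ _) (*-congˡ (collect (up F N)))))
        where
        pointwise : ∀ {S} → BoundedBy N S →
          gate (S (suc N)) (term (suc N) S) +ᵣ gate (insert N S (suc N)) (term (suc N) (insert N S))
          ≈ el F (suc N) *ᵣ (if up F N then gate (S N) (term N S) else term N S)
        pointwise {S} S⊆ =
          ≈-trans (+-cong (gate-cong (S⊆ (suc N) ≤-refl) ≈-refl) (gate-cong (insert-new N S) ≈-refl))
                  (≈-trans (+-identityˡ _) (term-insert S))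
        collect : ∀ u → sumOver (subsets N) (λ S → if u then gate (S N) (term N S) else term N S)
                        ≈ (if u then weightIn N else weightIn N +ᵣ weightOut N)
        collect true  = ≈-refl
        collect false = sum-terms≈in+out N

      weightOut-step : weightOut (suc N) ≈ (if up F N then weightIn N +ᵣ weightOut N else weightOut N)
      weightOut-step = ≈-trans (sumOver-pairs (subsets N) (insert N) _)
        (≈-trans (sumOver-cong (All.map pointwise (subsets-bounded N))) (collect (up F N)))
        where
        pointwise : ∀ {S} → BoundedBy N S →
          gate (not (S (suc N))) (term (suc N) S) +ᵣ gate (not (insert N S (suc N))) (term (suc N) (insert N S))
          ≈ (if up F N then term N S else gate (not (S N)) (term N S))
        pointwise {S} S⊆ =
          ≈-trans (+-cong (gate-cong (cong not (S⊆ (suc N) ≤-refl)) ≈-refl)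
                          (gate-cong (cong not (insert-new N S)) ≈-refl))
                  (≈-trans (+-identityʳ _) (term-keep S S⊆))
        collect : ∀ u → sumOver (subsets N) (λ S → if u then term N S else gate (not (S N)) (term N S))
                        ≈ (if u then weightIn N +ᵣ weightOut N else weightOut N)
        collect true  = sum-terms≈in+out N
        collect false = ≈-refl

    columns-segment : ∀ m → weightIn (suc m) ≈ column₁ (segment (up F) (el F) 1 m)
                           × weightOut (suc m) ≈ column₂ (segment (up F) (el F) 1 m)
    columns-segment zero =
      solve 1 (λ e → con 0 :+ (e :* con 1 :+ con 0) := Poly.column₁ (Poly.weightMat e Poly.⊠ Poly.idMat))
              ≈-refl (el F 1) ,
      solve 1 (λ e → con 1 :* con 1 :+ (con 0 :+ con 0) := Poly.column₂ (Poly.weightMat e Poly.⊠ Poly.idMat))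
              ≈-refl (el F 1)
    columns-segment (suc m) =
      ≈-trans (weightIn-step m) (≈-trans (*-congˡ (if-cong (up F (suc m)) inₘ (+-cong inₘ outₘ)))
        (≈-sym (≈-trans (column₁-cong (segment-snoc (up F) (el F) 1 m)) (column₁-step _ _ _)))) ,
      ≈-trans (weightOut-step m) (≈-trans (if-cong (up F (suc m)) (+-cong inₘ outₘ) outₘ)
        (≈-sym (≈-trans (column₂-cong (segment-snoc (up F) (el F) 1 m)) (column₂-step _ _ (el F (suc (suc m)))))))
      where
      inₘ  = proj₁ (columns-segment m)
      outₘ = proj₂ (columns-segment m)
      if-cong : ∀ b {x x′ y y′} → x ≈ x′ → y ≈ y′ → (if b then x else y) ≈ (if b then x′ else y′)
      if-cong true  x≈x′ _    = x≈x′
      if-cong false _    y≈y′ = y≈y′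

    W≈transferWeight : W F ≈ transferWeight (len F) (up F) (el F)
    W≈transferWeight = ≈-trans W≈sum-terms (by-length (len F))
      where
      by-length : ∀ n → sumOver (subsets n) (term n) ≈ transferWeight n (up F) (el F)
      by-length zero    = +-identityʳ _
      by-length (suc m) = ≈-trans (sum-terms≈in+out (suc m))
        (+-cong (proj₁ (columns-segment m)) (proj₂ (columns-segment m)))

  -- positions 1, …, a
  leftBlock : (ℕ → Bool) → (ℕ → Carrier) → ℕ → Mat
  leftBlock u e zero    = leftEnd
  leftBlock u e (suc a) = segment u e 1 a

  -- positions x, …, x + q - 1
  rightBlock : (ℕ → Bool) → (ℕ → Carrier) → ℕ → ℕ → Mat
  rightBlock u e x zero    = rightEnd
  rightBlock u e x (suc q) = segment u e x q

  leftBlock-cong : ∀ {u₁ e₁ u₂ e₂} a →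
    (∀ k → suc k < a → u₁ (suc k) ≡ u₂ (suc k)) → (∀ k → k < a → e₁ (suc k) ≈ e₂ (suc k)) →
    leftBlock u₁ e₁ a ≋ leftBlock u₂ e₂ a
  leftBlock-cong zero    _   _   = ≋-refl
  leftBlock-cong (suc a) u≡ e≈ =
    segment-cong _ _ _ _ 1 1 a (λ k k<a → u≡ k (s≤s k<a)) (λ k k≤a → e≈ k (s≤s k≤a))

  rightBlock-cong : ∀ {u₁ e₁ u₂ e₂} x y q →
    (∀ k → suc k < q → u₁ (x + k) ≡ u₂ (y + k)) → (∀ k → k < q → e₁ (x + k) ≈ e₂ (y + k)) →
    rightBlock u₁ e₁ x q ≋ rightBlock u₂ e₂ y q
  rightBlock-cong x y zero    _   _   = ≋-refl
  rightBlock-cong x y (suc q) u≡ e≈ =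
    segment-cong _ _ _ _ x y q (λ k k<q → u≡ k (s≤s k<q)) (λ k k≤q → e≈ k (s≤s k≤q))

  total-leftEnd : ∀ A → total (leftEnd ⊠ (stepMat true ⊠ A)) ≈ total A
  total-leftEnd (mat a b c d) = solve 4 (λ a b c d →
    Poly.total (Poly.leftEnd Poly.⊠ (Poly.stepMat true Poly.⊠ mat a b c d)) := Poly.total (mat a b c d)) ≈-refl a b c d

  total-rightEnd : ∀ L M →
    total (L ⊠ (stepMat true ⊠ (M ⊠ (stepMat true ⊠ rightEnd)))) ≈ total (L ⊠ (stepMat true ⊠ M))
  total-rightEnd (mat a b c d) (mat e f g h) = solve 8 (λ a b c d e f g h →
    Poly.total (mat a b c d Poly.⊠ (Poly.stepMat true Poly.⊠
                  (mat e f g h Poly.⊠ (Poly.stepMat true Poly.⊠ Poly.rightEnd))))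
    := Poly.total (mat a b c d Poly.⊠ (Poly.stepMat true Poly.⊠ mat e f g h))) ≈-refl a b c d e f g h

  transferWeight-left : ∀ u e a k → (0 < a → u a ≡ true) →
    total (segment u e 1 (a + k)) ≈ total (leftBlock u e a ⊠ (stepMat true ⊠ segment u e (suc a) k))
  transferWeight-left u e zero    k _    = ≈-sym (total-leftEnd _)
  transferWeight-left u e (suc a) k up-a = total-cong (≋-trans
    (≋-reflexive (cong (segment u e 1) (sym (+-suc a k))))
    (≋-trans (segment-split u e 1 a k) (⊠-congˡ (⊠-congʳ (≋-reflexive (cong stepMat (up-a z<s)))))))

  transferWeight-right : ∀ u e L x m q → (0 < q → u (x + m) ≡ true) →
    total (L ⊠ (stepMat true ⊠ segment u e x (m + q))) ≈
    total (L ⊠ (stepMat true ⊠ (segment u e x m ⊠ (stepMat true ⊠ rightBlock u e (suc (x + m)) q))))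
  transferWeight-right u e L x m zero    _    =
    ≈-trans (total-cong (⊠-congˡ (⊠-congˡ (≋-reflexive (cong (segment u e x) (ℕₚ.+-identityʳ m))))))
            (≈-sym (total-rightEnd _ _))
  transferWeight-right u e L x m (suc q) up-t = total-cong (⊠-congˡ (⊠-congˡ
    (≋-trans (segment-split u e x m q) (⊠-congˡ (⊠-congʳ (≋-reflexive (cong stepMat (up-t z<s))))))))

  transferWeight-blocks : ∀ u e a m q → (0 < a → u a ≡ true) → (0 < q → u (suc a + m) ≡ true) →
    transferWeight (suc a + m + q) u e ≈
    total (leftBlock u e a ⊠ (stepMat true ⊠
             (segment u e (suc a) m ⊠ (stepMat true ⊠ rightBlock u e (suc (suc a + m)) q))))
  transferWeight-blocks u e a m q up-a up-t =
    ≈-trans (total-cong (≋-reflexive (cong (segment u e 1) (ℕₚ.+-assoc a m q))))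
      (≈-trans (transferWeight-left u e a (m + q) up-a) (transferWeight-right u e _ (suc a) m q up-t))

  total-leftEnd-descending : ∀ p x → total (leftEnd ⊠ (stepMat false ⊠ mat p 0# x 1#)) ≈ p
  total-leftEnd-descending = solve 2 (λ p x →
    Poly.total (Poly.leftEnd Poly.⊠ (Poly.stepMat false Poly.⊠ mat p (con 0) x (con 1))) := p) ≈-refl

  total-leftEnd-descending-ascent : ∀ p x N →
    total (leftEnd ⊠ (stepMat false ⊠ (mat p 0# x 1# ⊠ (stepMat true ⊠ N)))) ≈ p *ᵣ total N
  total-leftEnd-descending-ascent p x (mat a b c d) = solve 6 (λ p x a b c d →
    Poly.total (Poly.leftEnd Poly.⊠ (Poly.stepMat false Poly.⊠
                  (mat p (con 0) x (con 1) Poly.⊠ (Poly.stepMat true Poly.⊠ mat a b c d))))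
    := p :* Poly.total (mat a b c d)) ≈-refl p x a b c d

  total-descending-rightEnd : ∀ p x → total (mat p 0# x 1# ⊠ (stepMat false ⊠ rightEnd)) ≈ 1#
  total-descending-rightEnd = solve 2 (λ p x →
    Poly.total (mat p (con 0) x (con 1) Poly.⊠ (Poly.stepMat false Poly.⊠ Poly.rightEnd)) := con 1) ≈-refl

  total-ascent-descending-rightEnd : ∀ L p x →
    total ((L ⊠ (stepMat true ⊠ mat p 0# x 1#)) ⊠ (stepMat false ⊠ rightEnd)) ≈ total L
  total-ascent-descending-rightEnd (mat a b c d) p x = solve 6 (λ a b c d p x →
    Poly.total ((mat a b c d Poly.⊠ (Poly.stepMat true Poly.⊠ mat p (con 0) x (con 1)))
                  Poly.⊠ (Poly.stepMat false Poly.⊠ Poly.rightEnd))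
    := Poly.total (mat a b c d)) ≈-refl a b c d p x

  -- Congruence transforms shift the skew part by the determinant

  Skew : Mat → Carrier → Set ℓ
  Skew Z z = m21 Z ≈ m12 Z +ᵣ z

  Skew-resp : ∀ {A B z} → A ≋ B → Skew A z → Skew B z
  Skew-resp A≋B skew = ≈-trans (≈-sym (≋21 A≋B)) (≈-trans skew (+-congʳ (≋12 A≋B)))

  conj-cong : ∀ {Z Z′} S → Z ≋ Z′ → conj Z S ≋ conj Z′ S
  conj-cong S Z≋Z′ = ⊠-congˡ (⊠-congʳ Z≋Z′)

  conj-⊠ : ∀ Z A B → conj Z (A ⊠ B) ≋ conj (conj Z A) B
  conj-⊠ Z A B =
    ≋-trans (⊠-cong (ᵀ-⊠ A B) (≋-sym (⊠-assoc Z A B)))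
      (≋-trans (⊠-assoc _ _ _) (⊠-congˡ (≋-sym (⊠-assoc _ _ _))))

  Skew-conj-step : ∀ b w {Z z} → Skew Z z → Skew (conj Z (stepMat b ⊠ weightMat w)) (z *ᵣ w)
  Skew-conj-step b w {mat p q r s} {z} skew =
    Skew-resp (conj-cong _ (≋-sym Z≋)) (symmetric-part b p q s z w)
    where
    Z≋ : mat p q r s ≋ mat p q (q +ᵣ z) s
    Z≋ = mk≋ ≈-refl ≈-refl skew ≈-refl
    symmetric-part : ∀ b p q s z w → Skew (conj (mat p q (q +ᵣ z) s) (stepMat b ⊠ weightMat w)) (z *ᵣ w)
    symmetric-part true = solve 5 (λ p q s z w →
      m21 (Poly.conj (mat p q (q :+ z) s) (Poly.stepMat true Poly.⊠ Poly.weightMat w)) :=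
      m12 (Poly.conj (mat p q (q :+ z) s) (Poly.stepMat true Poly.⊠ Poly.weightMat w)) :+ z :* w) ≈-refl
    symmetric-part false = solve 5 (λ p q s z w →
      m21 (Poly.conj (mat p q (q :+ z) s) (Poly.stepMat false Poly.⊠ Poly.weightMat w)) :=
      m12 (Poly.conj (mat p q (q :+ z) s) (Poly.stepMat false Poly.⊠ Poly.weightMat w)) :+ z :* w) ≈-refl

  Skew-congʳ : ∀ {Z z z′} → z ≈ z′ → Skew Z z → Skew Z z′
  Skew-congʳ z≈z′ skew = ≈-trans skew (+-congˡ z≈z′)

  Skew-conj-steps : ∀ u e a m {Z z} → Skew Z z → Skew (conj Z (steps u e a m)) (z *ᵣ prodFrom e m (suc a))
  Skew-conj-steps u e a zero    {Z} skew =
    Skew-congʳ {conj Z idMat} (≈-sym (*-identityʳ _))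
      (Skew-resp (≋-sym (≋-trans (⊠-identityˡ _) (⊠-identityʳ Z))) skew)
  Skew-conj-steps u e a (suc m) {Z} {z} skew =
    Skew-resp {conj (conj Z (C ⊠ D)) Y}
      (≋-sym (≋-trans (conj-cong-right (≋-sym (⊠-assoc C D Y))) (conj-⊠ Z (C ⊠ D) Y)))
      (Skew-congʳ {conj (conj Z (C ⊠ D)) Y} (*-assoc z _ _)
        (Skew-conj-steps u e (suc a) m (Skew-conj-step (u a) (e (suc a)) skew)))
    where
    C D Y : Mat
    C = stepMat (u a)
    D = weightMat (e (suc a))
    Y = steps u e (suc a) m
    conj-cong-right : ∀ {S S′} → S ≋ S′ → conj Z S ≋ conj Z S′
    conj-cong-right S≋S′ = ⊠-cong (ᵀ-cong S≋S′) (⊠-congˡ S≋S′)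

  -- The segment P[r, t], t = r + 2n + 1, of a fence whose halves P[r, s] and
  -- P[s+1, t] are mirror images glued by the down-step P(s) > P(s+1).
  overlap-skew : ∀ u e r n → u (r + n) ≡ false →
    (∀ k → k < n → u (r + k) ≡ not (u (suc (r + n) + (n ∸ suc k)))) →
    (∀ k → k < n → e (r + k) ≈ e (suc (r + n) + (n ∸ k))) →
    Skew (segment u e r (n + suc n)) (prodFrom e (suc n) (suc (r + n)))
  overlap-skew u e r n down u-mirror e-mirror =
    Skew-resp (≋-sym segment≋conj) (Skew-conj-steps u e (suc s) n (glue (e s) (e (suc s))))
    where
    s : ℕ
    s = r + n
    Y : Mat
    Y = steps u e (suc s) n
    glue : ∀ x y → Skew (weightMat x ⊠ (stepMat false ⊠ weightMat y)) y
    glue = solve 2 (λ x y → m21 (Poly.weightMat x Poly.⊠ (Poly.stepMat false Poly.⊠ Poly.weightMat y))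
                          := m12 (Poly.weightMat x Poly.⊠ (Poly.stepMat false Poly.⊠ Poly.weightMat y)) :+ y) ≈-refl
    segment≋conj : segment u e r (n + suc n) ≋ conj (weightMat (e s) ⊠ (stepMat false ⊠ weightMat (e (suc s)))) Y
    segment≋conj =
      ≋-trans (segment-split u e r n n)
      (≋-trans (⊠-cong (segment-reverse u e u e r (suc s) n u-mirror e-mirror)
                       (⊠-congʳ (≋-reflexive (cong stepMat down))))
      (≋-trans (⊠-congʳ (ᵀ-⊠ _ Y))
      (≋-trans (⊠-assoc _ _ _)
        (⊠-congˡ (≋-trans (⊠-congˡ (≋-sym (⊠-assoc _ _ _))) (≋-sym (⊠-assoc _ _ _)))))))

  -- K - Kᵀ = z (E₂₁ - E₁₂)  and  C(up) (E₂₁ - E₁₂) C(up) = C(down).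
  total-transpose-middle : ∀ L K R z → Skew K z →
    total (L ⊠ (stepMat true ⊠ (K ⊠ (stepMat true ⊠ R)))) ≈
    total (L ⊠ (stepMat true ⊠ (K ᵀ ⊠ (stepMat true ⊠ R)))) +ᵣ z *ᵣ total (L ⊠ (stepMat false ⊠ R))
  total-transpose-middle (mat l₁ l₂ l₃ l₄) (mat k₁ k₂ k₃ k₄) (mat r₁ r₂ r₃ r₄) z skew =
    ≈-trans (total-cong (⊠-congˡ (⊠-congˡ (⊠-congʳ K≋))))
      (≈-trans (identity l₁ l₂ l₃ l₄ k₁ k₂ k₄ z r₁ r₂ r₃ r₄)
        (+-congʳ (total-cong (⊠-congˡ (⊠-congˡ (⊠-congʳ (ᵀ-cong (≋-sym K≋))))))))
    where
    K≋ : mat k₁ k₂ k₃ k₄ ≋ mat k₁ k₂ (k₂ +ᵣ z) k₄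
    K≋ = mk≋ ≈-refl ≈-refl skew ≈-refl
    identity : ∀ l₁ l₂ l₃ l₄ k₁ k₂ k₄ z r₁ r₂ r₃ r₄ →
      let L = mat l₁ l₂ l₃ l₄; K = mat k₁ k₂ (k₂ +ᵣ z) k₄; R = mat r₁ r₂ r₃ r₄ in
      total (L ⊠ (stepMat true ⊠ (K ⊠ (stepMat true ⊠ R)))) ≈
      total (L ⊠ (stepMat true ⊠ (K ᵀ ⊠ (stepMat true ⊠ R)))) +ᵣ z *ᵣ total (L ⊠ (stepMat false ⊠ R))
    identity = solve 12 (λ l₁ l₂ l₃ l₄ k₁ k₂ k₄ z r₁ r₂ r₃ r₄ →
      let L = mat l₁ l₂ l₃ l₄; K = mat k₁ k₂ (k₂ :+ z) k₄; R = mat r₁ r₂ r₃ r₄ in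
      Poly.total (L Poly.⊠ (Poly.stepMat true Poly.⊠ (K Poly.⊠ (Poly.stepMat true Poly.⊠ R)))) :=
      Poly.total (L Poly.⊠ (Poly.stepMat true Poly.⊠ (K Poly.ᵀ Poly.⊠ (Poly.stepMat true Poly.⊠ R))))
        :+ z :* Poly.total (L Poly.⊠ (Poly.stepMat false Poly.⊠ R))) ≈-refl

  descending-segment : ∀ u e a m → (∀ k → k < m → u (a + k) ≡ false) →
    segment u e a m ≋ mat (prodFrom e (suc m) a) 0# (m21 (segment u e a m)) 1#
  descending-segment u e a zero _ = mk≋
    (solve 1 (λ w → w :* con 1 :+ con 0 :* con 0 := w :* con 1) ≈-refl (e a))
    (solve 1 (λ w → w :* con 0 :+ con 0 :* con 1 := con 0) ≈-refl (e a))
    ≈-refl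
    (solve 1 (λ w → con 0 :* con 0 :+ con 1 :* con 1 := con 1) ≈-refl (e a))
  descending-segment u e a (suc m) down = mk≋
    (≈-trans (≋11 rest≋) (proj₁ shape)) (≈-trans (≋12 rest≋) (proj₁ (proj₂ shape)))
    ≈-refl (≈-trans (≋22 rest≋) (proj₂ (proj₂ shape)))
    where
    N : Mat
    N = segment u e (suc a) m
    rest≋ : segment u e a (suc m) ≋
            weightMat (e a) ⊠ (stepMat false ⊠ mat (prodFrom e (suc m) (suc a)) 0# (m21 N) 1#)
    rest≋ = ⊠-congˡ (⊠-cong
      (≋-reflexive (cong stepMat (subst (λ x → u x ≡ false) (ℕₚ.+-identityʳ a) (down 0 z<s))))
      (descending-segment u e (suc a) m (λ k k<m → subst (λ x → u x ≡ false) (+-suc a k) (down (suc k) (s≤s k<m)))))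
    prepended : ∀ {k} → Polynomial k → Polynomial k → Polynomial k → Mat₂ (Polynomial k)
    prepended w p x = Poly.weightMat w Poly.⊠ (Poly.stepMat false Poly.⊠ mat p (con 0) x (con 1))
    entries : ∀ w p x → let M = weightMat w ⊠ (stepMat false ⊠ mat p 0# x 1#) in
              m11 M ≈ w *ᵣ p × m12 M ≈ 0# × m22 M ≈ 1#
    entries w p x =
      solve 3 (λ w p x → m11 (prepended w p x) := w :* p) ≈-refl w p x ,
      solve 3 (λ w p x → m12 (prepended w p x) := con 0) ≈-refl w p x ,
      solve 3 (λ w p x → m22 (prepended w p x) := con 1) ≈-refl w p x
    shape : let M = weightMat (e a) ⊠ (stepMat false ⊠ mat (prodFrom e (suc m) (suc a)) 0# (m21 N) 1#) in
            m11 M ≈ prodFrom e (suc (suc m)) a × m12 M ≈ 0# × m22 M ≈ 1#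
    shape = entries (e a) (prodFrom e (suc m) (suc a)) (m21 N)

  segment-sub : ∀ F a b m → segment (up (sub F a b)) (el (sub F a b)) 1 m ≋ segment (up F) (el F) a m
  segment-sub F a b m = segment-cong _ _ _ _ 1 a m (λ k _ → sub-up F a b k) (λ k _ → ≈-reflexive (sub-el F a b k))

  W-empty : ∀ F → len F ≡ 0 → W F ≈ 1#
  W-empty F len≡0 = ≈-trans (W≈transferWeight F) (≈-reflexive (cong (λ l → transferWeight l (up F) (el F)) len≡0))

  W-sub : ∀ F a b m → len (sub F a b) ≡ suc m → W (sub F a b) ≈ total (segment (up F) (el F) a m)
  W-sub F a b m len≡1+m = ≈-trans (W≈transferWeight (sub F a b))
    (≈-trans (≈-reflexive (cong (λ l → transferWeight l (up (sub F a b)) (el (sub F a b))) len≡1+m))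
             (total-cong (segment-sub F a b m)))

  W-↘ : ∀ Q Q′ {a q} → len Q ≡ suc a → len Q′ ≡ suc q →
    W (Q ↘ Q′) ≈ total (segment (up Q) (el Q) 1 a ⊠ (stepMat false ⊠ segment (up Q′) (el Q′) 1 q))
  W-↘ Q@(mkFence _ _ _) Q′@(mkFence _ _ _) {a} {q} refl refl =
    ≈-trans (W≈transferWeight (Q ↘ Q′))
      (total-cong (≋-trans (segment-split _ _ 1 a q)
        (⊠-cong left (⊠-cong (≋-reflexive (cong stepMat (↘-up-join Q Q′))) right))))
    where
    left : segment (up (Q ↘ Q′)) (el (Q ↘ Q′)) 1 a ≋ segment (up Q) (el Q) 1 a
    left = segment-cong _ _ _ _ 1 1 a (λ k k<a → ↘-up-left Q Q′ (s≤s k<a))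
                                      (λ k k≤a → ≈-reflexive (↘-el-left Q Q′ (s≤s k≤a)))
    right : segment (up (Q ↘ Q′)) (el (Q ↘ Q′)) (suc (suc a)) q ≋ segment (up Q′) (el Q′) 1 q
    right = segment-cong _ _ _ _ (suc (suc a)) 1 q
      (λ k _ → subst (λ x → up (Q ↘ Q′) x ≡ up Q′ (suc k)) (+-suc (suc a) k) (↘-up-right Q Q′ k))
      (λ k _ → ≈-reflexive
        (subst (λ x → el (Q ↘ Q′) x ≡ el Q′ (suc k)) (+-suc (suc a) k) (↘-el-right Q Q′ k)))

  W-blocks : ∀ U wt a m q → (0 < a → U a ≡ true) → (0 < q → U (suc a + m) ≡ true) →
    W (mkFence (suc a + m + q) U wt) ≈
    total (leftBlock U wt a ⊠ (stepMat true ⊠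
             (segment U wt (suc a) m ⊠ (stepMat true ⊠ rightBlock U wt (suc (suc a + m)) q))))
  W-blocks U wt a m q up-a up-t =
    ≈-trans (W≈transferWeight (mkFence (suc a + m + q) U wt)) (transferWeight-blocks U wt a m q up-a up-t)

  W-P34-blocks : ∀ U wt a m q → let F = mkFence (suc a + m + q) U wt in
    W (P34 F (suc a) (suc a + m)) ≈
    total (leftBlock U wt a ⊠ (stepMat true ⊠
             (segment U wt (suc a) m ᵀ ⊠ (stepMat true ⊠ rightBlock U wt (suc (suc a + m)) q))))
  W-P34-blocks U wt a m q =
    ≈-trans (W≈transferWeight F₃₄)
      (≈-trans (transferWeight-blocks (up F₃₄) (el F₃₄) a m q
                  (λ _ → P34-up-before F a m) (λ _ → P34-up-after F a m))
        (total-cong (⊠-cong left (⊠-congˡ (⊠-cong middle (⊠-congˡ right))))))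
    where
    F F₃₄ : Fence Carrier
    F = mkFence (suc a + m + q) U wt
    F₃₄ = P34 F (suc a) (suc a + m)
    left : leftBlock (up F₃₄) (el F₃₄) a ≋ leftBlock U wt a
    left = leftBlock-cong a (P34-up-left F a m) (λ k k<a → ≈-reflexive (P34-el-left F a m k k<a))
    middle : segment (up F₃₄) (el F₃₄) (suc a) m ≋ segment U wt (suc a) m ᵀ
    middle = ≋-trans (segment-reverse _ _ U wt (suc a) (suc a) m (P34-up-middle F a m)
                        (λ k k<m → ≈-reflexive (P34-el-middle F a m k (<⇒≤ k<m))))
      (ᵀ-cong (⊠-congʳ (≋-reflexive (cong weightMat (trans (P34-el-middle F a m m ≤-refl)
        (cong wt (trans (cong (suc a +_) (n∸n≡0 m)) (ℕₚ.+-identityʳ (suc a)))))))))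
    right : rightBlock (up F₃₄) (el F₃₄) (suc (suc a + m)) q ≋ rightBlock U wt (suc (suc a + m)) q
    right = rightBlock-cong _ _ q (λ k _ → P34-up-right F a m k) (λ k _ → ≈-reflexive (P34-el-right F a m k))

  W-P56-inner : ∀ U wt a t q →
    let F = mkFence (t + suc q) U wt in
    W (sub F 1 (suc a) ↘ sub F (suc t) (t + suc q)) ≈
    total (segment U wt 1 a ⊠ (stepMat false ⊠ segment U wt (suc t) q))
  W-P56-inner U wt a t q = ≈-trans (W-↘ (sub F 1 (suc a)) (sub F (suc t) (t + suc q)) refl (m+n∸m≡n t (suc q)))
    (total-cong (⊠-cong (segment-sub F 1 (suc a) a) (⊠-congˡ (segment-sub F (suc t) (t + suc q) q))))
    where
    F : Fence Carrier
    F = mkFence (t + suc q) U wt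

  -- For r = 1, P₅₆ drops the run of down-steps P(t+1) > … > P(v-1), whose weights
  -- are Z_t; for t = h it drops the run P(u+1) > … > P(r-1), which has weight 1 at
  -- the right end.
  Zt*W-after-run : ∀ U wt t j q → (∀ k → k < j → U (suc t + k) ≡ false) → U (suc t + j) ≡ true →
    let h = t + suc (j + suc q); v = suc (suc t + j) in
    prodRange wt (suc t) (v ∸ 1) *ᵣ W (sub (mkFence h U wt) v h) ≈
    total (leftEnd ⊠ (stepMat false ⊠ segment U wt (suc t) (j + suc q)))
  Zt*W-after-run U wt t j q run ascent = ≈-sym (begin
    total (leftEnd ⊠ (stepMat false ⊠ segment U wt (suc t) (j + suc q)))
      ≈⟨ total-cong (⊠-congˡ (⊠-congˡ (≋-trans (segment-split U wt (suc t) j q)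
           (⊠-cong (descending-segment U wt (suc t) j run)
                   (⊠-congʳ (≋-reflexive (cong stepMat ascent))))))) ⟩
    total (leftEnd ⊠ (stepMat false ⊠ (mat Zt 0# _ 1# ⊠ (stepMat true ⊠ segment U wt v q))))
      ≈⟨ total-leftEnd-descending-ascent Zt _ _ ⟩
    Zt *ᵣ total (segment U wt v q)
      ≈⟨ *-cong (≈-reflexive (sym Zt≡)) (≈-sym (W-sub F v h q len≡)) ⟩
    prodRange wt (suc t) (v ∸ 1) *ᵣ W (sub F v h) ∎)
    where
    open ≈-Reasoning
    h v : ℕ
    h = t + suc (j + suc q)
    v = suc (suc t + j)
    F : Fence Carrier
    F = mkFence h U wt
    Zt : Carrier
    Zt = prodFrom wt (suc j) (suc t)
    Zt≡ : prodRange wt (suc t) (v ∸ 1) ≡ Zt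
    Zt≡ = trans (prodRange≡prodFrom wt (suc t) (suc t + j))
      (cong (λ l → prodFrom wt l (suc t)) (trans (cong (_∸ t) (sym (+-suc t j))) (m+n∸m≡n t (suc j))))
    len≡ : len (sub F v h) ≡ suc q
    len≡ = trans (cong (_∸ (suc t + j)) (trans (+-suc t (j + suc q)) (cong suc (sym (ℕₚ.+-assoc t j (suc q))))))
                 (m+n∸m≡n (suc t + j) (suc q))

  Zt*W-after-descent : ∀ U wt t q → (∀ k → k < q → U (suc t + k) ≡ false) →
    let h = t + suc q in
    prodRange wt (suc t) (suc h ∸ 1) *ᵣ W (sub (mkFence h U wt) (suc h) h) ≈
    total (leftEnd ⊠ (stepMat false ⊠ segment U wt (suc t) q))
  Zt*W-after-descent U wt t q run = ≈-sym (begin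
    total (leftEnd ⊠ (stepMat false ⊠ segment U wt (suc t) q))
      ≈⟨ total-cong (⊠-congˡ (⊠-congˡ (descending-segment U wt (suc t) q run))) ⟩
    total (leftEnd ⊠ (stepMat false ⊠ mat Zt 0# _ 1#))
      ≈⟨ total-leftEnd-descending Zt _ ⟩
    Zt
      ≈⟨ ≈-sym (*-identityʳ Zt) ⟩
    Zt *ᵣ 1#
      ≈⟨ *-cong (≈-reflexive (sym Zt≡)) (≈-sym (W-empty (sub (mkFence h U wt) (suc h) h) (n∸n≡0 h))) ⟩
    prodRange wt (suc t) h *ᵣ W (sub (mkFence h U wt) (suc h) h) ∎)
    where
    open ≈-Reasoning
    h : ℕ
    h = t + suc q
    Zt : Carrier
    Zt = prodFrom wt (suc q) (suc t)
    Zt≡ : prodRange wt (suc t) h ≡ Zt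
    Zt≡ = trans (prodRange≡prodFrom wt (suc t) h) (cong (λ l → prodFrom wt l (suc t)) (m+n∸m≡n t (suc q)))

  W-before-descent : ∀ U wt a b → (∀ k → k < a → U (suc k) ≡ false) →
    W (sub (mkFence b U wt) 1 0) ≈ total (segment U wt 1 a ⊠ (stepMat false ⊠ rightEnd))
  W-before-descent U wt a b run = ≈-trans (W-empty (sub (mkFence b U wt) 1 0) refl) (≈-sym (≈-trans
    (total-cong (⊠-congʳ (descending-segment U wt 1 a run)))
    (total-descending-rightEnd _ _)))

  W-before-run : ∀ U wt u b c → U (suc u) ≡ true → (∀ k → k < b → U (suc (suc u) + k) ≡ false) →
    W (sub (mkFence c U wt) 1 (suc u)) ≈ total (segment U wt 1 (u + suc b) ⊠ (stepMat false ⊠ rightEnd))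
  W-before-run U wt u b c ascent run = ≈-sym (begin
    total (segment U wt 1 (u + suc b) ⊠ (stepMat false ⊠ rightEnd))
      ≈⟨ total-cong (⊠-congʳ (≋-trans (segment-split U wt 1 u b)
           (⊠-congˡ (⊠-cong (≋-reflexive (cong stepMat ascent))
                             (descending-segment U wt (suc (suc u)) b run))))) ⟩
    total ((segment U wt 1 u ⊠ (stepMat true ⊠ mat _ 0# _ 1#)) ⊠ (stepMat false ⊠ rightEnd))
      ≈⟨ total-ascent-descending-rightEnd _ _ _ ⟩
    total (segment U wt 1 u)
      ≈⟨ ≈-sym (W-sub (mkFence c U wt) 1 (suc u) u refl) ⟩
    W (sub (mkFence c U wt) 1 (suc u)) ∎)
    where open ≈-Reasoning

  module Kissing {a′} {L : Set a′} (U : ℕ → Bool) (E : ℕ → L) (wt : ℕ → Carrier) (a n q : ℕ) where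

    r s t : ℕ
    r = suc a
    s = r + n
    t = r + (n + suc n)

    P : Fence L
    P = mkFence (t + q) U E

    t≡1+s+n : t ≡ suc s + n
    t≡1+s+n = trans (sym (ℕₚ.+-assoc r n (suc n))) (+-suc s n)

    s<h : s < t + q
    s<h = ≤-trans (m≤m+n (suc s) n) (≤-trans (≤-reflexive (sym t≡1+s+n)) (m≤m+n t q))

    module _ (rk : ReverseKissing P wt r s t) where
      open ReverseKissing rk

      down-at-s : U s ≡ false
      down-at-s = ≢true⇒≡false λ up-s →
        top s (suc s) (r≤s , ≤-refl) (λ { (_ , 1+s≤s) → <-irrefl refl 1+s≤s }) [ up-step (s≤s z≤n) s<h up-s ]

      up-before : 0 < a → U a ≡ true
      up-before 0<a = ≢false⇒≡true λ down-a →
        top r a (≤-refl , r≤s) (λ { (r≤a , _) → <-irrefl refl r≤a })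
          [ down-step 0<a (≤-trans r≤s (<⇒≤ s<h)) down-a ]

      up-after : 0 < q → U t ≡ true
      up-after 0<q = ≢false⇒≡true λ down-t →
        bottom t (suc t) (s<t , ≤-refl) (λ { (_ , 1+t≤t) → <-irrefl refl 1+t≤t })
          [ down-step (s≤s z≤n) (subst (_≤ t + q) (ℕₚ.+-comm t 1) (+-monoʳ-≤ t 0<q)) down-t ]

      private
        s∸r≡n : s ∸ r ≡ n
        s∸r≡n = m+n∸m≡n r n

        t∸k : ∀ k → k ≤ n → t ∸ k ≡ suc s + (n ∸ k)
        t∸k k k≤n = trans (cong (_∸ k) t≡1+s+n) (+-∸-assoc (suc s) k≤n)

      mirror-weight : ∀ k → k < n → wt (r + k) ≈ wt (suc s + (n ∸ k))
      mirror-weight k k<n = subst (λ x → wt (r + k) ≈ wt x) (t∸k k (<⇒≤ k<n))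
        (weights k (subst (k <_) (sym s∸r≡n) k<n))

      mirror-up : ∀ k → k < n → U (r + k) ≡ not (U (suc s + (n ∸ suc k)))
      mirror-up k k<n = opposite (U (r + k)) ascending descending
        where
        X : ℕ
        X = suc s + (n ∸ suc k)
        t∸k≡1+X : t ∸ k ≡ suc X
        t∸k≡1+X = trans (t∸k k (<⇒≤ k<n)) (trans (cong (suc s +_) (+-∸-assoc 1 k<n)) (+-suc (suc s) (n ∸ suc k)))
        iso-forward : ∀ i j → i ≤ n → j ≤ n → (r + i) <[ P ] (r + j) → (t ∸ i) <[ P ] (t ∸ j)
        iso-forward i j i≤n j≤n =
          proj₁ (iso i j (subst (i ≤_) (sym s∸r≡n) i≤n) (subst (j ≤_) (sym s∸r≡n) j≤n))
        r+k<h : suc (r + k) ≤ t + q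
        r+k<h = ≤-trans (s≤s (+-monoʳ-≤ r (<⇒≤ k<n))) s<h
        ascending : U (r + k) ≡ true → U X ≡ false
        ascending up-rk = suc-lt⇒down P (subst₂ (_<[ P ]_) t∸k≡1+X (t∸k (suc k) k<n)
          (iso-forward k (suc k) (<⇒≤ k<n) k<n
            (subst ((r + k) <[ P ]_) (sym (+-suc r k)) [ up-step (s≤s z≤n) r+k<h up-rk ])))
        descending : U (r + k) ≡ false → U X ≡ true
        descending down-rk = lt-suc⇒up P (subst₂ (_<[ P ]_) (t∸k (suc k) k<n) t∸k≡1+X
          (iso-forward (suc k) k k<n (<⇒≤ k<n)
            (subst (_<[ P ] (r + k)) (sym (+-suc r k)) [ down-step (s≤s z≤n) r+k<h down-rk ])))
        opposite : ∀ b → (b ≡ true → U X ≡ false) → (b ≡ false → U X ≡ true) → b ≡ not (U X)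
        opposite true  f _ rewrite f refl = refl
        opposite false _ g rewrite g refl = refl

  Zt*W-after : ∀ {a′} {L : Set a′} (U : ℕ → Bool) (E : ℕ → L) wt t q v → IsV (mkFence (t + suc q) U E) t v →
    prodRange wt (suc t) (v ∸ 1) *ᵣ W (sub (mkFence (t + suc q) U wt) v (t + suc q)) ≈
    total (leftEnd ⊠ (stepMat false ⊠ segment U wt (suc t) q))
  Zt*W-after U E wt t q v isV@(2+t≤v , v≤1+h , _ , _) with v ≤? t + suc q
  ... | yes v≤h = run (v ∸ suc (suc t)) (t + suc q ∸ v) (m+[n∸m]≡n 2+t≤v) length isV v≤h
    where
    length : v ∸ suc (suc t) + suc (t + suc q ∸ v) ≡ q
    length = suc-injective (+-cancelˡ-≡ t _ _ (begin
      t + suc (v ∸ suc (suc t) + suc (t + suc q ∸ v))   ≡⟨ +-suc t _ ⟩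
      suc (t + (v ∸ suc (suc t) + suc (t + suc q ∸ v))) ≡⟨ cong suc (sym (ℕₚ.+-assoc t _ _)) ⟩
      suc (t + (v ∸ suc (suc t)) + suc (t + suc q ∸ v)) ≡⟨ cong suc (+-suc _ _) ⟩
      suc (suc t + (v ∸ suc (suc t))) + (t + suc q ∸ v) ≡⟨ cong (_+ (t + suc q ∸ v)) (m+[n∸m]≡n 2+t≤v) ⟩
      v + (t + suc q ∸ v)                               ≡⟨ m+[n∸m]≡n v≤h ⟩
      t + suc q                                         ∎))
      where open ≡-Reasoning
    run : ∀ {t q v} j q₂ → suc (suc t + j) ≡ v → j + suc q₂ ≡ q →
          IsV (mkFence (t + suc q) U E) t v → v ≤ t + suc q →
      prodRange wt (suc t) (v ∸ 1) *ᵣ W (sub (mkFence (t + suc q) U wt) v (t + suc q)) ≈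
      total (leftEnd ⊠ (stepMat false ⊠ segment U wt (suc t) q))
    run {t} j q₂ refl refl isV v≤h = Zt*W-after-run U wt t j q₂
      (λ k k<j → IsV⇒descending _ isV k (s≤s (+-monoʳ-< (suc t) k<j)))
      (IsV⇒ascent _ isV v≤h)
  ... | no v≰h = descent (≤-antisym v≤1+h (≰⇒> v≰h)) isV
    where
    descent : ∀ {v} → v ≡ suc (t + suc q) → IsV (mkFence (t + suc q) U E) t v →
      prodRange wt (suc t) (v ∸ 1) *ᵣ W (sub (mkFence (t + suc q) U wt) v (t + suc q)) ≈
      total (leftEnd ⊠ (stepMat false ⊠ segment U wt (suc t) q))
    descent refl isV = Zt*W-after-descent U wt t q λ k k<q → IsV⇒descending _ isV k
      (s≤s (subst (_≤ t + suc q) (trans (+-suc t (suc k)) (cong suc (+-suc t k))) (+-monoʳ-≤ t (s≤s k<q))))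

  W-before : ∀ {a′} {L : Set a′} (U : ℕ → Bool) (E : ℕ → L) wt a h u →
    IsU (mkFence h U E) (suc (suc a)) u → suc a ≤ h →
    W (sub (mkFence h U wt) 1 u) ≈ total (segment U wt 1 a ⊠ (stepMat false ⊠ rightEnd))
  W-before U E wt a h zero    isU _   =
    W-before-descent U wt a h λ k k<a → IsU⇒descending _ isU (suc k) (s≤s z≤n) (s≤s k<a)
  W-before U E wt a h (suc u) isU a<h = run (a ∸ suc u) (m+[n∸m]≡n (≤-pred (proj₁ isU))) isU a<h
    where
    run : ∀ {a} b → suc u + b ≡ a → IsU (mkFence h U E) (suc (suc a)) (suc u) → suc a ≤ h →
      W (sub (mkFence h U wt) 1 (suc u)) ≈ total (segment U wt 1 a ⊠ (stepMat false ⊠ rightEnd))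
    run b refl isU a<h =
      subst (λ a → W (sub (mkFence h U wt) 1 (suc u)) ≈ total (segment U wt 1 a ⊠ (stepMat false ⊠ rightEnd)))
      (+-suc u b)
      (W-before-run U wt u b h (IsU⇒ascent _ isU a<h (s≤s z≤n))
        (λ k k<b → IsU⇒descending _ isU (suc (suc u) + k) (s≤s (s≤s (m≤m+n u k)))
                                       (s≤s (+-monoʳ-< (suc u) k<b))))

  Zt*W56 : ∀ {a′} {L : Set a′} (U : ℕ → Bool) (E : ℕ → L) wt a n q v u →
    let open Kissing U E wt a n q in
    ReverseKissing P wt r s t → (r ≡ 1 → IsV P t v) → (t ≡ t + q → IsU P r u) →
    (if r ≡ᵇ 1 then prodRange wt (suc t) (v ∸ 1) else 1#) *ᵣ W (P56 (mkFence (t + q) U wt) r t v u) ≈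
    total (leftBlock U wt a ⊠ (stepMat false ⊠ rightBlock U wt (suc t) q))
  Zt*W56 U E wt zero n zero v u rk _ _ =
    ⊥-elim (ReverseKissing.notBoth rk (refl , sym (ℕₚ.+-identityʳ _)))
  Zt*W56 U E wt zero n (suc q) v u rk isV _ = Zt*W-after U E wt _ q v (isV refl)
  Zt*W56 U E wt (suc a) n zero v u rk _ isU =
    ≈-trans (*-identityˡ _) (≈-trans (≈-reflexive (cong W P56≡))
      (W-before U E wt a (t + 0) u (isU (sym (ℕₚ.+-identityʳ t)))
        (≤-trans (n≤1+n (suc a)) (≤-trans (m≤m+n r n) (≤-trans (<⇒≤ s<t) (m≤m+n t 0))))))
    where
    open Kissing U E wt (suc a) n zero
    open ReverseKissing rk using (s<t)
    P56≡ : P56 (mkFence (t + 0) U wt) r t v u ≡ sub (mkFence (t + 0) U wt) 1 u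
    P56≡ = if-true (trans (cong (t ≡ᵇ_) (ℕₚ.+-identityʳ t)) (≡ᵇ-refl t))
  Zt*W56 U E wt (suc a) n (suc q) v u rk _ _ =
    ≈-trans (*-identityˡ _) (≈-trans (≈-reflexive (cong W P56≡)) (W-P56-inner U wt a t q))
    where
    open Kissing U E wt (suc a) n (suc q)
    F : Fence Carrier
    F = mkFence (t + suc q) U wt
    P56≡ : P56 F r t v u ≡ (sub F 1 (suc a) ↘ sub F (suc t) (t + suc q))
    P56≡ = if-false (≢⇒≡ᵇ-false (λ t≡t+1+q → m+1+n≢m t (sym t≡t+1+q)))

  reverse-kissing-identity : ∀ {a′} {L : Set a′} (U : ℕ → Bool) (E : ℕ → L) wt a n q →
    let open Kissing U E wt a n q in
    ReverseKissing P wt r s t → (v u : ℕ) → (r ≡ 1 → IsV P t v) → (t ≡ t + q → IsU P r u) →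
    Identity P wt r s t v u
  reverse-kissing-identity U E wt a n q rk v u isV isU = begin
    W (mkFence (t + q) U wt)
      ≈⟨ W-blocks U wt a m q (up-before rk) (up-after rk) ⟩
    total (Lb ⊠ (stepMat true ⊠ (K ⊠ (stepMat true ⊠ Rb))))
      ≈⟨ total-transpose-middle Lb K Rb ZR skew ⟩
    total (Lb ⊠ (stepMat true ⊠ (K ᵀ ⊠ (stepMat true ⊠ Rb)))) +ᵣ ZR *ᵣ total (Lb ⊠ (stepMat false ⊠ Rb))
      ≈⟨ +-cong (≈-sym (W-P34-blocks U wt a m q)) (*-congˡ (≈-sym (Zt*W56 U E wt a n q v u rk isV isU))) ⟩
    W F₃₄ +ᵣ ZR *ᵣ (Zt *ᵣ W F₅₆)
      ≈⟨ +-congˡ (≈-sym (*-assoc ZR Zt _)) ⟩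
    W F₃₄ +ᵣ (ZR *ᵣ Zt) *ᵣ W F₅₆ ∎
    where
    open ≈-Reasoning
    open Kissing U E wt a n q
    m : ℕ
    m = n + suc n
    K Lb Rb : Mat
    K  = segment U wt r m
    Lb = leftBlock U wt a
    Rb = rightBlock U wt (suc t) q
    F₃₄ F₅₆ : Fence Carrier
    F₃₄ = P34 (mkFence (t + q) U wt) r t
    F₅₆ = P56 (mkFence (t + q) U wt) r t v u
    ZR Zt : Carrier
    ZR = prodRange wt (suc s) t
    Zt = if r ≡ᵇ 1 then prodRange wt (suc t) (v ∸ 1) else 1#
    ZR≡ : ZR ≡ prodFrom wt (suc n) (suc s)
    ZR≡ = trans (prodRange≡prodFrom wt (suc s) t)
      (cong (λ l → prodFrom wt l (suc s)) (trans ([m+n]∸[m+o]≡n∸o r m n) (m+n∸m≡n n (suc n))))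
    skew : Skew K ZR
    skew = Skew-congʳ {K} (≈-reflexive (sym ZR≡)) (overlap-skew U wt r n (down-at-s rk) (mirror-up rk) (mirror-weight rk))

kissing-indices : ∀ {r s t h} → 1 ≤ r → r ≤ s → s < t → t ≤ h → s ∸ r ≡ t ∸ suc s →
  Σ ℕ λ a → Σ ℕ λ n → Σ ℕ λ q →
  suc a ≡ r × suc a + n ≡ s × suc a + (n + suc n) ≡ t × suc a + (n + suc n) + q ≡ h
kissing-indices {r} {s} {t} {h} 1≤r r≤s s<t t≤h lengths =
  r ∸ 1 , s ∸ r , h ∸ t , r≡ , s≡ , t≡ , trans (cong (_+ (h ∸ t)) t≡) (m+[n∸m]≡n t≤h)
  where
  r≡ : suc (r ∸ 1) ≡ r
  r≡ = m+[n∸m]≡n 1≤r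
  s≡ : suc (r ∸ 1) + (s ∸ r) ≡ s
  s≡ = trans (cong (_+ (s ∸ r)) r≡) (m+[n∸m]≡n r≤s)
  t≡ : suc (r ∸ 1) + (s ∸ r + suc (s ∸ r)) ≡ t
  t≡ = begin
    suc (r ∸ 1) + (s ∸ r + suc (s ∸ r)) ≡⟨ sym (ℕₚ.+-assoc (suc (r ∸ 1)) _ _) ⟩
    suc (r ∸ 1) + (s ∸ r) + suc (s ∸ r) ≡⟨ cong (_+ suc (s ∸ r)) s≡ ⟩
    s + suc (s ∸ r)                     ≡⟨ +-suc s _ ⟩
    suc s + (s ∸ r)                     ≡⟨ cong (suc s +_) lengths ⟩
    suc s + (t ∸ suc s)                 ≡⟨ m+[n∸m]≡n s<t ⟩
    t                                   ∎
    where open ≡-Reasoning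

proposition8p12 : ∀ {c ℓ a} (R : CommutativeRing c ℓ) (L : Set a)
    (P : Fence L) (wt : ℕ → CommutativeRing.Carrier R) (r s t : ℕ) →
    WithRing.ReverseKissing R P wt r s t →
    (v u : ℕ) → (r ≡ 1 → IsV P t v) → (t ≡ len P → IsU P r u) →
    WithRing.Identity R P wt r s t v u
proposition8p12 R L (mkFence h U E) wt r s t rk v u isV isU
  with kissing-indices 1≤r r≤s s<t t≤h lengths
  where open WithRing.ReverseKissing rk
... | a , n , q , refl , refl , refl , refl = reverse-kissing-identity R U E wt a n q rk v u isV isU
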